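{- Let $K_n=(V,E)$ be the complete graph with $|V|=n\ge 2$. For every cut $X$, the degree of the vertex $K^{+}_{\min}(X)$ in the graph of the cone partition for the min-cut problem with non-negative edges satisfies $2^{\lceil n/2\rceil}+2^{\lfloor n/2\rfloor}-4\le \deg\big(K^{+}_{\min}(X)\big)\le 2^{n-1}-2.$
   Context: Let $d=\binom{n}{2}=|E|$. For $S\subseteq V$, the cut vector $\mathbf{v}(S)\in\{0,1\}^{d}$ has coordinates indexed by edges $\{i,j\}\in E$, with $\mathbf{v}(S)_{i,j}=1$ if $|S\cap\{i,j\}|=1$ and $0$ otherwise. A cut is a nonempty proper subset $X\subset V$, where $X$ and its complement $V\setminus X$ are identified; the empty cut is excluded, so there are $2^{n-1}-1$ cuts. For a cut $X$, $K^{+}_{\min}(X)=\{\mathbf{c}\in\mathbb{R}^{d}:\ \mathbf{c}\ge\mathbf{0},\ \langle\mathbf{c},\mathbf{v}(X)\rangle\le\langle\mathbf{c},\mathbf{v}(Y)\rangle \text{ for all cuts } Y\}$. Two cones $K^{+}_{\min}(X),K^{+}_{\min}(Y)$ with $X\ne Y$ are adjacent if $\dim\big(K^{+}_{\min}(X)\cap K^{+}_{\min}(Y)\big)=d-1$. The graph of the cone partition has one vertex per cut and an edge between two cones iff they are adjacent.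
   Formalization: The cones $K^{+}_{\min}(X)$ consist of rational vectors $\mathbf{c}$ in ℚ^d instead of $\mathbb{R}^{d}$, so their intersections and dimensions are taken over ℚ. -}

module Defs where

open import Data.Nat using (ℕ; zero; suc)
open import Data.Bool using (Bool; true; false; _xor_)
open import Data.Fin using (Fin; _<_; _<?_)
open import Data.Fin.Subset using (Subset; Nonempty; ∁)
open import Data.Vec using (Vec; []; _∷_; lookup)
open import Data.Product using (Σ; _×_; _,_; ∃)
open import Data.Rational using (ℚ; 0ℚ; _+_; _*_; _≤_)
open import Data.Empty using (⊥)
open import Relation.Nullary using (¬_; yes; no)
open import Relation.Binary.PropositionalEquality using (_≡_; _≢_)

Edge : ℕ → Set
Edge n = Σ (Fin n × Fin n) (λ p → Data.Product.proj₁ p < Data.Product.proj₂ p)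

EVec : ℕ → Set
EVec n = Edge n → ℚ

sumFin : ∀ {k} → (Fin k → ℚ) → ℚ
sumFin {zero}  f = 0ℚ
sumFin {suc k} f = f Fin.zero + sumFin (λ i → f (Fin.suc i))

toℚ : Bool → ℚ
toℚ true  = Data.Rational.1ℚ
toℚ false = 0ℚ

crosses : ∀ {n} → Subset n → Fin n → Fin n → Bool
crosses S i j = lookup S i xor lookup S j

cutValue : ∀ {n} → EVec n → Subset n → ℚ
cutValue {n} c S = sumFin (λ i → sumFin (λ j → term i j))
  where
  term : Fin n → Fin n → ℚ
  term i j with i <? j
  ... | yes p = c ((i , j) , p) * toℚ (crosses S i j)
  ... | no  _ = 0ℚ

ProperNonempty : ∀ {n} → Subset n → Set
ProperNonempty S = Nonempty S × Nonempty (∁ S)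

ZeroNotIn : ∀ {n} → Subset n → Set
ZeroNotIn []      = ⊥
ZeroNotIn (b ∷ _) = b ≡ false

-- Canonical representative of a cut {X, V∖X}: the side not containing vertex 0
-- (nonempty, and automatically proper).
IsCut : ∀ {n} → Subset n → Set
IsCut S = ZeroNotIn S × Nonempty S

Kmin : ∀ {n} → Subset n → EVec n → Set
Kmin {n} X c =
  (∀ e → 0ℚ ≤ c e) ×
  (∀ (Y : Subset n) → ProperNonempty Y → cutValue c X ≤ cutValue c Y)

LinIndep : ∀ {n k} → (Fin k → EVec n) → Set
LinIndep {n} {k} u =
  ∀ (λs : Fin k → ℚ) → (∀ e → sumFin (λ i → λs i * u i e) ≡ 0ℚ) → ∀ i → λs i ≡ 0ℚ

HasIndep : ∀ {n} → (EVec n → Set) → ℕ → Set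
HasIndep {n} C k = Σ (Fin k → EVec n) (λ u → (∀ i → C (u i)) × LinIndep u)

-- dim C = k  (dimension of the linear span of C, i.e. maximal number of
-- linearly independent vectors of C; for cones this is the usual dimension).
HasDim : ∀ {n} → (EVec n → Set) → ℕ → Set
HasDim C k = HasIndep C k × ¬ HasIndep C (suc k)

numEdges : ℕ → ℕ
numEdges n = Data.Nat.⌊ n Data.Nat.* (n Data.Nat.∸ 1) /2⌋

Adjacent : ∀ {n} → Subset n → Subset n → Set
Adjacent {n} X Y =
  X ≢ Y × HasDim (λ c → Kmin X c × Kmin Y c) (numEdges n Data.Nat.∸ 1)

-- The cones of two cuts X ≠ Y are adjacent exactly when X and Y do not cross.  Their common face
-- satisfies cut X = cut Y, so it has dimension at most d − 1.  If X and Y cross, submodularity of the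
-- cut function also forces weight 0 on the edges between X ∖ Y and Y ∖ X, a second independent
-- constraint.  If X ⊂ Y, say, the vertices fall into three classes, and every edge e but one yields a
-- vector on the face: e itself, corrected by a fixed edge between two classes and by all edges inside
-- the classes; suitably ordered, these d − 1 vectors are unitriangular.  The cuts nested with X,
-- |X| = k, number (2^k − 2) + 2 (2^(n−k−1) − 1), least for a balanced split; all other cuts give the
-- upper bound.

module Submission where

module SubsetLookup where

  open import Data.Nat using (ℕ)
  open import Data.Bool using (true; false; not)
  open import Data.Bool.Properties using (not-injective) renaming (_≟_ to _≟ᴮ_)
  open import Data.Fin.Properties using (all?; ¬∀⟶∃¬)
  open import Data.Fin.Subset using (Subset; _∈_; _∉_; ∁)
  open import Data.Vec using (lookup)
  open import Data.Vec.Properties using (lookup-map; []=⇒lookup; lookup⇒[]=)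
  open import Data.Vec.Relation.Binary.Pointwise.Extensional using (ext; Pointwise-≡⇒≡)
  open import Data.Product using (∃)
  open import Relation.Binary.PropositionalEquality
  open import Relation.Nullary using (yes; no)
  open import Data.Empty using (⊥-elim)

  private
    variable
      n : ℕ

  true≢false : true ≢ false
  true≢false ()

  ∈⇒lookup : ∀ {S : Subset n} {v} → v ∈ S → lookup S v ≡ true
  ∈⇒lookup = []=⇒lookup

  lookup⇒∈ : ∀ {S : Subset n} {v} → lookup S v ≡ true → v ∈ S
  lookup⇒∈ {S = S} {v} = lookup⇒[]= v S

  lookup⇒∉ : ∀ {S : Subset n} {v} → lookup S v ≡ false → v ∉ S
  lookup⇒∉ Sv≡false v∈S = true≢false (trans (sym (∈⇒lookup v∈S)) Sv≡false)

  lookup⇒∈∁ : ∀ {S : Subset n} {v} → lookup S v ≡ false → v ∈ ∁ S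
  lookup⇒∈∁ {S = S} {v} Sv≡false = lookup⇒[]= v (∁ S) (trans (lookup-map v not S) (cong not Sv≡false))

  ∈∁⇒lookup : ∀ {S : Subset n} {v} → v ∈ ∁ S → lookup S v ≡ false
  ∈∁⇒lookup {S = S} {v} v∈∁S = not-injective (trans (sym (lookup-map v not S)) ([]=⇒lookup v∈∁S))

  differing-vertex : ∀ {X Y : Subset n} → X ≢ Y → ∃ λ v → lookup X v ≢ lookup Y v
  differing-vertex {n} {X} {Y} X≢Y with all? (λ v → lookup X v ≟ᴮ lookup Y v)
  ... | yes X≗Y = ⊥-elim (X≢Y (Pointwise-≡⇒≡ (ext X≗Y)))
  ... | no X≭Y  = ¬∀⟶∃¬ n _ (λ v → lookup X v ≟ᴮ lookup Y v) X≭Y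

module Sums where

  open import Defs using (sumFin)
  open import Algebra.Bundles using (Ring)
  open import Data.Nat using (zero; suc)
  open import Data.Fin using (Fin; zero; suc; punchIn)
  open import Data.Fin.Properties using (punchInᵢ≢i)
  open import Data.Rational using (ℚ; 0ℚ; _+_; _≤_)
  open import Data.Rational.Properties
    using (+-*-ring; ≤-refl; ≤-trans; ≤-reflexive; +-mono-≤; +-monoʳ-≤; +-identityʳ; module ≤-Reasoning)
  open import Relation.Binary.PropositionalEquality

  open import Algebra.Properties.Semiring.Sum (Ring.semiring +-*-ring) public
    using ( sum; sum-cong-≗; ∑-distrib-+; ∑-comm; *-distribˡ-sum; *-distribʳ-sum
          ; sum-remove; sum-replicate-zero)

  sumFin≡sum : ∀ {k} (f : Fin k → ℚ) → sumFin f ≡ sum f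
  sumFin≡sum {zero}  f = refl
  sumFin≡sum {suc k} f = cong (f zero +_) (sumFin≡sum (λ i → f (suc i)))

  sum-mono-≤ : ∀ {k} {f g : Fin k → ℚ} → (∀ i → f i ≤ g i) → sum f ≤ sum g
  sum-mono-≤ {zero}  f≤g = ≤-refl
  sum-mono-≤ {suc k} f≤g = +-mono-≤ (f≤g zero) (sum-mono-≤ (λ i → f≤g (suc i)))

  sum-zero : ∀ {k} {f : Fin k → ℚ} → (∀ i → f i ≡ 0ℚ) → sum f ≡ 0ℚ
  sum-zero {k} f≡0 = trans (sum-cong-≗ f≡0) (sum-replicate-zero k)

  sum-nonneg : ∀ {k} {f : Fin k → ℚ} → (∀ i → 0ℚ ≤ f i) → 0ℚ ≤ sum f
  sum-nonneg {k} 0≤f = ≤-trans (≤-reflexive (sym (sum-zero {k} (λ _ → refl)))) (sum-mono-≤ 0≤f)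

  ≤-sum : ∀ {k} {f : Fin k → ℚ} → (∀ i → 0ℚ ≤ f i) → ∀ p → f p ≤ sum f
  ≤-sum {suc _} {f} 0≤f p = begin
    f p                                ≡⟨ +-identityʳ (f p) ⟨
    f p + 0ℚ                           ≤⟨ +-monoʳ-≤ (f p) (sum-nonneg (λ j → 0≤f (punchIn p j))) ⟩
    f p + sum (λ j → f (punchIn p j))  ≡⟨ sum-remove f ⟨
    sum f                              ∎
    where open ≤-Reasoning

  sum-single : ∀ {k} {f : Fin k → ℚ} p → (∀ i → i ≢ p → f i ≡ 0ℚ) → sum f ≡ f p
  sum-single {suc _} {f} p off = begin
    sum f                              ≡⟨ sum-remove f ⟩
    f p + sum (λ j → f (punchIn p j))  ≡⟨ cong (f p +_) (sum-zero (λ j → off (punchIn p j) (punchInᵢ≢i p j))) ⟩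
    f p + 0ℚ                           ≡⟨ +-identityʳ (f p) ⟩
    f p                                ∎
    where open ≡-Reasoning

module Edges where

  open import Defs using (Edge; crosses)
  open import Data.Nat using (ℕ)
  open import Data.Bool using (Bool; _xor_)
  open import Data.Bool.Properties using (xor-assoc; xor-comm; xor-same)
  open import Data.Fin using (Fin)
  open import Data.Fin.Properties as Fin using (<-cmp; <-irrelevant)
  open import Data.Fin.Subset using (Subset)
  open import Data.Vec using (lookup)
  open import Data.Product using (_,_; proj₁; proj₂)
  open import Data.Product.Properties using (≡-dec)
  open import Relation.Binary using (tri<; tri≈; tri>)
  open import Relation.Binary.PropositionalEquality
  open import Relation.Nullary using (Dec; yes)
  open import Data.Empty using (⊥-elim)

  private
    variable
      n : ℕ

  src tgt : Edge n → Fin n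
  src e = proj₁ (proj₁ e)
  tgt e = proj₂ (proj₁ e)

  edge-≡ : ∀ {e f : Edge n} → src e ≡ src f → tgt e ≡ tgt f → e ≡ f
  edge-≡ {e = (_ , p)} {f = (_ , q)} refl refl = cong (_ ,_) (<-irrelevant p q)

  _≟ᴱ_ : (e f : Edge n) → Dec (e ≡ f)
  _≟ᴱ_ = ≡-dec (≡-dec Fin._≟_ Fin._≟_) (λ p q → yes (<-irrelevant p q))

  edge : (u v : Fin n) → u ≢ v → Edge n
  edge u v u≢v with <-cmp u v
  ... | tri< u<v _ _ = (u , v) , u<v
  ... | tri≈ _ u≡v _ = ⊥-elim (u≢v u≡v)
  ... | tri> _ _ v<u = (v , u) , v<u

  separates : Subset n → Edge n → Bool
  separates S e = crosses S (src e) (tgt e)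

  separates-edge : ∀ (S : Subset n) u v (u≢v : u ≢ v) → separates S (edge u v u≢v) ≡ crosses S u v
  separates-edge S u v u≢v with <-cmp u v
  ... | tri< _ _ _ = refl
  ... | tri≈ _ u≡v _ = ⊥-elim (u≢v u≡v)
  ... | tri> _ _ _ = xor-comm (lookup S v) (lookup S u)

  xor-cancelʳ : ∀ x y b → (x xor b) xor (y xor b) ≡ x xor y
  xor-cancelʳ x y b = begin
    (x xor b) xor (y xor b)  ≡⟨ xor-assoc x b (y xor b) ⟩
    x xor (b xor (y xor b))  ≡⟨ cong (λ t → x xor (b xor t)) (xor-comm y b) ⟩
    x xor (b xor (b xor y))  ≡⟨ cong (x xor_) (xor-assoc b b y) ⟨
    x xor ((b xor b) xor y)  ≡⟨ cong (λ t → x xor (t xor y)) (xor-same b) ⟩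
    x xor y                  ∎
    where open ≡-Reasoning

  separates-xor : ∀ {Z S : Subset n} {b} → (∀ v → lookup Z v ≡ lookup S v xor b) →
    ∀ e → separates Z e ≡ separates S e
  separates-xor {S = S} {b} Z≡S⊕b e rewrite Z≡S⊕b (src e) | Z≡S⊕b (tgt e) =
    xor-cancelʳ (lookup S (src e)) (lookup S (tgt e)) b

module EdgeSums where

  open import Defs using (Edge; EVec; toℚ)
  open Sums
  open Edges
  open import Data.Nat using (ℕ)
  open import Data.Bool using (true; false)
  open import Data.Fin using (Fin; _<?_)
  open import Data.Product using (_,_)
  open import Data.Rational using (ℚ; 0ℚ; 1ℚ; _+_; _*_; _-_; -_; _≤_; nonNegative)
  open import Data.Rational.Solver using (module +-*-Solver)
  open import Data.Rational.Properties
    using ( ≤-refl; ≤ᵇ⇒≤; *-zeroˡ; *-zeroʳ; *-identityˡ; *-comm; *-assoc; *-distribˡ-+; *-distribʳ-+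
          ; *-monoˡ-≤-nonNeg; nonNeg*nonNeg⇒nonNeg; nonNegative⁻¹; module ≤-Reasoning)
  open import Relation.Binary.PropositionalEquality
  open import Relation.Nullary using (yes; no; does)
  open import Relation.Nullary.Decidable using (dec-true; dec-false)
  open import Data.Empty using (⊥-elim)
  open import Function using (_∘_)

  private
    variable
      n : ℕ

  onEdge : (Edge n → ℚ) → Fin n → Fin n → ℚ
  onEdge f i j with i <? j
  ... | yes i<j = f ((i , j) , i<j)
  ... | no _    = 0ℚ

  Σᴱ : (Edge n → ℚ) → ℚ
  Σᴱ f = sum (λ i → sum (λ j → onEdge f i j))

  onEdge-at : ∀ (f : Edge n → ℚ) e → onEdge f (src e) (tgt e) ≡ f e
  onEdge-at f ((i , j) , i<j) with i <? j
  ... | yes _   = cong f (edge-≡ refl refl)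
  ... | no i≮j = ⊥-elim (i≮j i<j)

  onEdge-off : ∀ (f : Edge n → ℚ) i j → (∀ i<j → f ((i , j) , i<j) ≡ 0ℚ) → onEdge f i j ≡ 0ℚ
  onEdge-off f i j f≡0 with i <? j
  ... | yes i<j = f≡0 i<j
  ... | no _    = refl

  onEdge-rel : ∀ (R : ℚ → ℚ → Set) → R 0ℚ 0ℚ → ∀ (f g : Edge n → ℚ) → (∀ e → R (f e) (g e)) →
    ∀ i j → R (onEdge f i j) (onEdge g i j)
  onEdge-rel R R00 f g fRg i j with i <? j
  ... | yes _ = fRg _
  ... | no _  = R00

  onEdge-+ : ∀ (f g : Edge n → ℚ) i j → onEdge (λ e → f e + g e) i j ≡ onEdge f i j + onEdge g i j
  onEdge-+ f g i j with i <? j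
  ... | yes _ = refl
  ... | no _  = refl

  onEdge-sum : ∀ {k} (g : Fin k → Edge n → ℚ) i j →
    onEdge (λ e → sum (λ l → g l e)) i j ≡ sum (λ l → onEdge (g l) i j)
  onEdge-sum {k = k} g i j with i <? j
  ... | yes _ = refl
  ... | no _  = sym (sum-zero {k} (λ _ → refl))

  Σᴱ-cong : ∀ {f g : Edge n → ℚ} → (∀ e → f e ≡ g e) → Σᴱ f ≡ Σᴱ g
  Σᴱ-cong {f = f} {g} f≡g = sum-cong-≗ (λ i → sum-cong-≗ (onEdge-rel _≡_ refl f g f≡g i))

  Σᴱ-mono-≤ : ∀ {f g : Edge n → ℚ} → (∀ e → f e ≤ g e) → Σᴱ f ≤ Σᴱ g
  Σᴱ-mono-≤ {f = f} {g} f≤g = sum-mono-≤ (λ i → sum-mono-≤ (onEdge-rel _≤_ ≤-refl f g f≤g i))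

  Σᴱ-zero : ∀ {f : Edge n → ℚ} → (∀ e → f e ≡ 0ℚ) → Σᴱ f ≡ 0ℚ
  Σᴱ-zero {f = f} f≡0 = sum-zero (λ i → sum-zero (onEdge-rel (λ x _ → x ≡ 0ℚ) refl f f f≡0 i))

  onEdge-nonneg : ∀ {f : Edge n → ℚ} → (∀ e → 0ℚ ≤ f e) → ∀ i j → 0ℚ ≤ onEdge f i j
  onEdge-nonneg {f = f} 0≤f = onEdge-rel (λ _ x → 0ℚ ≤ x) ≤-refl f f 0≤f

  Σᴱ-nonneg : ∀ {f : Edge n → ℚ} → (∀ e → 0ℚ ≤ f e) → 0ℚ ≤ Σᴱ f
  Σᴱ-nonneg 0≤f = sum-nonneg (λ i → sum-nonneg (onEdge-nonneg 0≤f i))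

  Σᴱ-+ : ∀ (f g : Edge n → ℚ) → Σᴱ (λ e → f e + g e) ≡ Σᴱ f + Σᴱ g
  Σᴱ-+ f g = begin
    Σᴱ (λ e → f e + g e)
      ≡⟨ sum-cong-≗ (λ i → sum-cong-≗ (onEdge-+ f g i)) ⟩
    sum (λ i → sum (λ j → onEdge f i j + onEdge g i j))
      ≡⟨ sum-cong-≗ (λ i → ∑-distrib-+ (onEdge f i) (onEdge g i)) ⟩
    sum (λ i → sum (onEdge f i) + sum (onEdge g i))
      ≡⟨ ∑-distrib-+ (λ i → sum (onEdge f i)) (λ i → sum (onEdge g i)) ⟩
    Σᴱ f + Σᴱ g ∎
    where open ≡-Reasoning

  Σᴱ-scale : ∀ r (f : Edge n → ℚ) → Σᴱ (λ e → r * f e) ≡ r * Σᴱ f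
  Σᴱ-scale r f = begin
    Σᴱ (λ e → r * f e)
      ≡⟨ sum-cong-≗ (λ i → sum-cong-≗ (onEdge-rel (λ x y → y ≡ r * x) (sym (*-zeroʳ r)) f (λ e → r * f e)
                                                  (λ _ → refl) i)) ⟩
    sum (λ i → sum (λ j → r * onEdge f i j))
      ≡⟨ sum-cong-≗ (λ i → *-distribˡ-sum r (onEdge f i)) ⟨
    sum (λ i → r * sum (onEdge f i))
      ≡⟨ *-distribˡ-sum r (λ i → sum (onEdge f i)) ⟨
    r * Σᴱ f ∎
    where open ≡-Reasoning

  Σᴱ-sum : ∀ {k} (g : Fin k → Edge n → ℚ) → Σᴱ (λ e → sum (λ l → g l e)) ≡ sum (λ l → Σᴱ (g l))
  Σᴱ-sum g = begin
    Σᴱ (λ e → sum (λ l → g l e))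
      ≡⟨ sum-cong-≗ (λ i → sum-cong-≗ (onEdge-sum g i)) ⟩
    sum (λ i → sum (λ j → sum (λ l → onEdge (g l) i j)))
      ≡⟨ sum-cong-≗ (λ i → ∑-comm (λ j l → onEdge (g l) i j)) ⟩
    sum (λ i → sum (λ l → sum (λ j → onEdge (g l) i j)))
      ≡⟨ ∑-comm (λ i l → sum (onEdge (g l) i)) ⟩
    sum (λ l → Σᴱ (g l)) ∎
    where open ≡-Reasoning

  ≤-Σᴱ : ∀ {f : Edge n → ℚ} → (∀ e → 0ℚ ≤ f e) → ∀ e → f e ≤ Σᴱ f
  ≤-Σᴱ {f = f} 0≤f e = begin
    f e                       ≡⟨ onEdge-at f e ⟨
    onEdge f (src e) (tgt e)  ≤⟨ ≤-sum (onEdge-nonneg 0≤f (src e)) (tgt e) ⟩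
    sum (onEdge f (src e))    ≤⟨ ≤-sum (λ i → sum-nonneg (onEdge-nonneg 0≤f i)) (src e) ⟩
    Σᴱ f                      ∎
    where open ≤-Reasoning

  Σᴱ-single : ∀ {f : Edge n → ℚ} e → (∀ e′ → e′ ≢ e → f e′ ≡ 0ℚ) → Σᴱ f ≡ f e
  Σᴱ-single {f = f} e off = begin
    Σᴱ f                      ≡⟨ sum-single (src e) off-row ⟩
    sum (onEdge f (src e))    ≡⟨ sum-single (tgt e) off-column ⟩
    onEdge f (src e) (tgt e)  ≡⟨ onEdge-at f e ⟩
    f e                       ∎
    where
    open ≡-Reasoning
    off-row : ∀ i → i ≢ src e → sum (onEdge f i) ≡ 0ℚ
    off-row i i≢s = sum-zero (λ j → onEdge-off f i j (λ _ → off _ (i≢s ∘ cong src)))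
    off-column : ∀ j → j ≢ tgt e → onEdge f (src e) j ≡ 0ℚ
    off-column j j≢t = onEdge-off f (src e) j (λ _ → off _ (j≢t ∘ cong tgt))

  NonNeg : EVec n → Set
  NonNeg c = ∀ e → 0ℚ ≤ c e

  *-nonneg : ∀ {x y} → 0ℚ ≤ x → 0ℚ ≤ y → 0ℚ ≤ x * y
  *-nonneg {x} {y} 0≤x 0≤y =
    nonNegative⁻¹ (x * y) {{nonNeg*nonNeg⇒nonNeg x {{nonNegative 0≤x}} y {{nonNegative 0≤y}}}}

  toℚ-nonneg : ∀ b → 0ℚ ≤ toℚ b
  toℚ-nonneg true  = ≤ᵇ⇒≤ _
  toℚ-nonneg false = ≤-refl

  ⟨_,_⟩ : EVec n → EVec n → ℚ
  ⟨ c , w ⟩ = Σᴱ (λ e → c e * w e)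

  ⟨⟩-comm : ∀ (c w : EVec n) → ⟨ c , w ⟩ ≡ ⟨ w , c ⟩
  ⟨⟩-comm c w = Σᴱ-cong (λ e → *-comm (c e) (w e))

  ⟨⟩-congʳ : ∀ (c : EVec n) {w w′ : EVec n} → (∀ e → w e ≡ w′ e) → ⟨ c , w ⟩ ≡ ⟨ c , w′ ⟩
  ⟨⟩-congʳ c w≡w′ = Σᴱ-cong (λ e → cong (c e *_) (w≡w′ e))

  ⟨⟩-+ˡ : ∀ (c c′ w : EVec n) → ⟨ (λ e → c e + c′ e) , w ⟩ ≡ ⟨ c , w ⟩ + ⟨ c′ , w ⟩
  ⟨⟩-+ˡ c c′ w =
    trans (Σᴱ-cong (λ e → *-distribʳ-+ (w e) (c e) (c′ e))) (Σᴱ-+ (λ e → c e * w e) (λ e → c′ e * w e))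

  ⟨⟩-+ʳ : ∀ (c w w′ : EVec n) → ⟨ c , (λ e → w e + w′ e) ⟩ ≡ ⟨ c , w ⟩ + ⟨ c , w′ ⟩
  ⟨⟩-+ʳ c w w′ =
    trans (Σᴱ-cong (λ e → *-distribˡ-+ (c e) (w e) (w′ e))) (Σᴱ-+ (λ e → c e * w e) (λ e → c e * w′ e))

  ⟨⟩-scaleˡ : ∀ r (c w : EVec n) → ⟨ (λ e → r * c e) , w ⟩ ≡ r * ⟨ c , w ⟩
  ⟨⟩-scaleˡ r c w = trans (Σᴱ-cong (λ e → *-assoc r (c e) (w e))) (Σᴱ-scale r (λ e → c e * w e))

  ⟨⟩-−ʳ : ∀ (c w w′ : EVec n) → ⟨ c , (λ e → w e - w′ e) ⟩ ≡ ⟨ c , w ⟩ - ⟨ c , w′ ⟩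
  ⟨⟩-−ʳ c w w′ = begin
    Σᴱ (λ e → c e * (w e - w′ e))
      ≡⟨ Σᴱ-cong (λ e → solve 3 (λ c w w′ → c :* (w :- w′) := c :* w :+ con (- 1ℚ) :* (c :* w′))
                                refl (c e) (w e) (w′ e)) ⟩
    Σᴱ (λ e → c e * w e + - 1ℚ * (c e * w′ e))
      ≡⟨ Σᴱ-+ (λ e → c e * w e) (λ e → - 1ℚ * (c e * w′ e)) ⟩
    ⟨ c , w ⟩ + Σᴱ (λ e → - 1ℚ * (c e * w′ e))
      ≡⟨ cong (⟨ c , w ⟩ +_) (Σᴱ-scale (- 1ℚ) (λ e → c e * w′ e)) ⟩
    ⟨ c , w ⟩ + - 1ℚ * ⟨ c , w′ ⟩
      ≡⟨ solve 2 (λ x y → x :+ con (- 1ℚ) :* y := x :- y) refl ⟨ c , w ⟩ ⟨ c , w′ ⟩ ⟩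
    ⟨ c , w ⟩ - ⟨ c , w′ ⟩ ∎
    where
    open ≡-Reasoning
    open +-*-Solver

  ⟨⟩-combˡ : ∀ {k} (λs : Fin k → ℚ) (u : Fin k → EVec n) (w : EVec n) →
    ⟨ (λ e → sum (λ i → λs i * u i e)) , w ⟩ ≡ sum (λ i → λs i * ⟨ u i , w ⟩)
  ⟨⟩-combˡ λs u w = begin
    Σᴱ (λ e → sum (λ i → λs i * u i e) * w e)
      ≡⟨ Σᴱ-cong (λ e → *-distribʳ-sum (w e) (λ i → λs i * u i e)) ⟩
    Σᴱ (λ e → sum (λ i → λs i * u i e * w e))
      ≡⟨ Σᴱ-sum (λ i e → λs i * u i e * w e) ⟩
    sum (λ i → Σᴱ (λ e → λs i * u i e * w e))
      ≡⟨ sum-cong-≗ (λ i → ⟨⟩-scaleˡ (λs i) (u i) w) ⟩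
    sum (λ i → λs i * ⟨ u i , w ⟩) ∎
    where open ≡-Reasoning

  ⟨⟩-nonneg : ∀ {c w : EVec n} → NonNeg c → NonNeg w → 0ℚ ≤ ⟨ c , w ⟩
  ⟨⟩-nonneg 0≤c 0≤w = Σᴱ-nonneg (λ e → *-nonneg (0≤c e) (0≤w e))

  ⟨⟩-monoʳ-≤ : ∀ {c w w′ : EVec n} → NonNeg c → (∀ e → w e ≤ w′ e) → ⟨ c , w ⟩ ≤ ⟨ c , w′ ⟩
  ⟨⟩-monoʳ-≤ {c = c} 0≤c w≤w′ =
    Σᴱ-mono-≤ (λ e → *-monoˡ-≤-nonNeg (c e) {{nonNegative (0≤c e)}} (w≤w′ e))

  ≤-⟨⟩ : ∀ {c w : EVec n} → NonNeg c → NonNeg w → ∀ e → c e * w e ≤ ⟨ c , w ⟩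
  ≤-⟨⟩ 0≤c 0≤w = ≤-Σᴱ (λ e → *-nonneg (0≤c e) (0≤w e))

  δ : Edge n → EVec n
  δ f e = toℚ (does (e ≟ᴱ f))

  δ-same : ∀ (f : Edge n) → δ f f ≡ 1ℚ
  δ-same f = cong toℚ (dec-true (f ≟ᴱ f) refl)

  δ-other : ∀ {e f : Edge n} → e ≢ f → δ f e ≡ 0ℚ
  δ-other {e = e} {f} e≢f = cong toℚ (dec-false (e ≟ᴱ f) e≢f)

  δ-nonneg : ∀ (f : Edge n) → NonNeg (δ f)
  δ-nonneg f e = toℚ-nonneg (does (e ≟ᴱ f))

  ⟨δ,_⟩ : ∀ {f : Edge n} (w : EVec n) → ⟨ δ f , w ⟩ ≡ w f
  ⟨δ,_⟩ {f = f} w = begin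
    Σᴱ (λ e → δ f e * w e)  ≡⟨ Σᴱ-single f (λ e e≢f → trans (cong (_* w e) (δ-other e≢f)) (*-zeroˡ (w e))) ⟩
    δ f f * w f             ≡⟨ cong (_* w f) (δ-same f) ⟩
    1ℚ * w f                ≡⟨ *-identityˡ (w f) ⟩
    w f                     ∎
    where open ≡-Reasoning

  ⟨_,δ⟩ : ∀ (c : EVec n) {f : Edge n} → ⟨ c , δ f ⟩ ≡ c f
  ⟨ c ,δ⟩ = trans (⟨⟩-comm c _) ⟨δ, c ⟩

module EdgeCount where

  open import Defs using (Edge; numEdges)
  open Edges using (edge-≡)
  open import Data.Nat using (ℕ; zero; suc; _+_; _*_; _∸_; ⌊_/2⌋; s≤s; z≤n)
  open import Data.Nat.Properties using (n≡⌊n+n/2⌋)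
  open import Data.Nat.Solver using (module +-*-Solver)
  open import Data.Fin using (Fin; zero; suc; splitAt; join; punchIn)
  open import Data.Fin.Properties using (splitAt-join; join-splitAt; punchInᵢ≢i; punchIn-injective)
  open import Data.Sum using (inj₁; inj₂)
  open import Data.Product using (_,_)
  open import Relation.Binary.PropositionalEquality

  pairs : ℕ → ℕ
  pairs zero    = 0
  pairs (suc n) = n + pairs n

  pairs-double : ∀ n → pairs n + pairs n ≡ n * (n ∸ 1)
  pairs-double zero          = refl
  pairs-double (suc zero)    = refl
  pairs-double (suc (suc n)) = begin
    (suc n + p) + (suc n + p)
      ≡⟨ solve 2 (λ m q → (m :+ q) :+ (m :+ q) := (m :+ m) :+ (q :+ q)) refl (suc n) p ⟩
    (suc n + suc n) + (p + p)
      ≡⟨ cong ((suc n + suc n) +_) (pairs-double (suc n)) ⟩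
    (suc n + suc n) + suc n * n
      ≡⟨ solve 1 (λ m → ((con 1 :+ m) :+ (con 1 :+ m)) :+ (con 1 :+ m) :* m := (con 2 :+ m) :* (con 1 :+ m))
                 refl n ⟩
    suc (suc n) * suc n ∎
    where
    p = pairs (suc n)
    open ≡-Reasoning
    open +-*-Solver

  numEdges≡pairs : ∀ n → numEdges n ≡ pairs n
  numEdges≡pairs n = trans (cong ⌊_/2⌋ (sym (pairs-double n))) (sym (n≡⌊n+n/2⌋ (pairs n)))

  -- The edges at vertex 0 come first, followed by those among the vertices 1, …, n.
  toEdge : ∀ {n} → Fin (pairs n) → Edge n
  toEdge {suc n} x with splitAt n x
  ... | inj₁ j = (zero , suc j) , s≤s z≤n
  ... | inj₂ y with toEdge {n} y
  ...   | (i , j) , i<j = (suc i , suc j) , s≤s i<j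

  fromEdge : ∀ {n} → Edge n → Fin (pairs n)
  fromEdge {suc n} ((zero , suc j) , _)       = join n (pairs n) (inj₁ j)
  fromEdge {suc n} ((suc i , suc j) , s≤s i<j) = join n (pairs n) (inj₂ (fromEdge ((i , j) , i<j)))

  toEdge-fromEdge : ∀ {n} (e : Edge n) → toEdge (fromEdge e) ≡ e
  toEdge-fromEdge {suc n} ((zero , suc j) , _) rewrite splitAt-join n (pairs n) (inj₁ j) = edge-≡ refl refl
  toEdge-fromEdge {suc n} ((suc i , suc j) , s≤s i<j)
    rewrite splitAt-join n (pairs n) (inj₂ (fromEdge ((i , j) , i<j))) | toEdge-fromEdge ((i , j) , i<j) = refl

  fromEdge-toEdge : ∀ {n} (x : Fin (pairs n)) → fromEdge (toEdge {n} x) ≡ x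
  fromEdge-toEdge {suc n} x with splitAt n x in eq
  ... | inj₁ j = trans (cong (join n (pairs n)) (sym eq)) (join-splitAt n (pairs n) x)
  ... | inj₂ y with toEdge {n} y in eq′
  ...   | (i , j) , i<j =
    trans (cong (λ z → join n (pairs n) (inj₂ z)) (trans (cong fromEdge (sym eq′)) (fromEdge-toEdge {n} y)))
          (trans (cong (join n (pairs n)) (sym eq)) (join-splitAt n (pairs n) x))

  enum : ∀ {n} → Fin (numEdges n) → Edge n
  enum {n} x = toEdge (subst Fin (numEdges≡pairs n) x)

  index : ∀ {n} → Edge n → Fin (numEdges n)
  index {n} e = subst Fin (sym (numEdges≡pairs n)) (fromEdge e)

  enum-index : ∀ {n} (e : Edge n) → enum (index e) ≡ e
  enum-index {n} e = trans (cong toEdge (subst-subst-sym (numEdges≡pairs n))) (toEdge-fromEdge e)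

  index-enum : ∀ {n} (x : Fin (numEdges n)) → index (enum {n} x) ≡ x
  index-enum {n} x =
    trans (cong (subst Fin (sym (numEdges≡pairs n))) (fromEdge-toEdge {n} _)) (subst-sym-subst (numEdges≡pairs n))

  skip : ∀ {d} → Fin d → Fin (d ∸ 1) → Fin d
  skip {suc d} p = punchIn p

  skip-≢ : ∀ {d} (p : Fin d) j → skip p j ≢ p
  skip-≢ {suc d} p j = punchInᵢ≢i p j

  skip-injective : ∀ {d} (p : Fin d) {i j} → skip p i ≡ skip p j → i ≡ j
  skip-injective {suc d} p = punchIn-injective p _ _

  edgesBut : ∀ {n} → Edge n → Fin (numEdges n ∸ 1) → Edge n
  edgesBut e₀ j = enum (skip (index e₀) j)

  edgesBut-≢ : ∀ {n} (e₀ : Edge n) j → edgesBut e₀ j ≢ e₀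
  edgesBut-≢ {n} e₀ j eq = skip-≢ (index e₀) j (trans (sym (index-enum {n} _)) (cong index eq))

  edgesBut-injective : ∀ {n} (e₀ : Edge n) {i j} → edgesBut e₀ i ≡ edgesBut e₀ j → i ≡ j
  edgesBut-injective {n} e₀ eq =
    skip-injective (index e₀) (trans (sym (index-enum {n} _)) (trans (cong index eq) (index-enum {n} _)))

module Independence where

  open import Defs using (EVec; Edge; LinIndep; HasIndep; numEdges)
  open Sums
  open EdgeSums using (⟨_,_⟩; ⟨⟩-combˡ; Σᴱ-zero; δ)
  open EdgeCount using (enum; index; enum-index)
  open import Data.Nat using (ℕ; zero; suc; _≤_; _<_; z≤n; s≤s)
  open import Data.Nat.Properties using (m≤n⇒m≤1+n; ≤-refl; <-≤-trans; ≮⇒≥) renaming (_<?_ to _<ℕ?_)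
  open import Data.Fin using (Fin; zero; suc; punchIn)
  open import Data.Fin.Properties using (any?)
  open import Data.Vec.Functional using (_∷_; insertAt)
  open import Data.Vec.Functional.Properties using (insertAt-lookup; insertAt-punchIn)
  open import Data.Rational using (ℚ; 0ℚ; 1ℚ; _+_; _*_; _-_; -_; 1/_; NonZero; ≢-nonZero)
  open import Data.Rational.Properties
    using ( _≟_; 1≢0; *-zeroˡ; *-zeroʳ; *-identityʳ; *-assoc; *-inverseˡ; *-inverseʳ
          ; +-inverseʳ; +-identityˡ; +-identityʳ)
  open import Data.Rational.Solver using (module +-*-Solver)
  open import Data.Product using (_,_)
  open import Function using (_∘_)
  open import Relation.Binary.PropositionalEquality
  open import Relation.Nullary using (¬_; yes; no; ¬?)
  open import Relation.Nullary.Decidable using (decidable-stable)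
  open import Data.Empty using (⊥-elim)

  Independent : ∀ {A : Set} {k} → (Fin k → A → ℚ) → Set
  Independent {k = k} u =
    ∀ (λs : Fin k → ℚ) → (∀ a → sum (λ i → λs i * u i a) ≡ 0ℚ) → ∀ i → λs i ≡ 0ℚ

  LinIndep⇒Independent : ∀ {n k} {u : Fin k → EVec n} → LinIndep u → Independent u
  LinIndep⇒Independent {u = u} indep λs comb≡0 =
    indep λs (λ e → trans (sumFin≡sum (λ i → λs i * u i e)) (comb≡0 e))

  Independent⇒LinIndep : ∀ {n k} {u : Fin k → EVec n} → Independent u → LinIndep u
  Independent⇒LinIndep {u = u} indep λs comb≡0 =
    indep λs (λ e → trans (sym (sumFin≡sum (λ i → λs i * u i e))) (comb≡0 e))

  Independent-reindex : ∀ {A B : Set} {k} {u : Fin k → A → ℚ} (g : B → A) (h : A → B) →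
    (∀ a → g (h a) ≡ a) → Independent u → Independent (λ i b → u i (g b))
  Independent-reindex {u = u} g h gh indep λs comb≡0 =
    indep λs (λ a → subst (λ a′ → sum (λ i → λs i * u i a′) ≡ 0ℚ) (gh a) (comb≡0 (h a)))

  x*y≡0⇒x≡0 : ∀ {x y : ℚ} → x * y ≡ 0ℚ → y ≢ 0ℚ → x ≡ 0ℚ
  x*y≡0⇒x≡0 {x} {y} xy≡0 y≢0 = begin
    x                ≡⟨ *-identityʳ x ⟨
    x * 1ℚ           ≡⟨ cong (x *_) (*-inverseʳ y) ⟨
    x * (y * 1/ y)   ≡⟨ *-assoc x y (1/ y) ⟨
    (x * y) * 1/ y   ≡⟨ cong (_* 1/ y) xy≡0 ⟩
    0ℚ * 1/ y        ≡⟨ *-zeroˡ (1/ y) ⟩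
    0ℚ               ∎
    where
    open ≡-Reasoning
    instance
      _ : NonZero y
      _ = ≢-nonZero y≢0

  drop-zero-coordinate : ∀ {m k} {u : Fin k → Fin (suc m) → ℚ} → (∀ i → u i zero ≡ 0ℚ) →
    Independent u → Independent (λ i a → u i (suc a))
  drop-zero-coordinate {u = u} u₀≡0 indep λs comb≡0 = indep λs λ where
    zero    → sum-zero (λ i → trans (cong (λs i *_) (u₀≡0 i)) (*-zeroʳ (λs i)))
    (suc a) → comb≡0 a

  sum-*-sub : ∀ {k} (μ y r : Fin k → ℚ) x →
    sum (λ j → μ j * (y j - r j * x)) ≡ - sum (λ j → μ j * r j) * x + sum (λ j → μ j * y j)
  sum-*-sub μ y r x = begin
    sum (λ j → μ j * (y j - r j * x))
      ≡⟨ sum-cong-≗ (λ j → solve 4 (λ m y r x → m :* (y :- r :* x) := m :* y :+ m :* r :* (:- x))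
                                 refl (μ j) (y j) (r j) x) ⟩
    sum (λ j → μ j * y j + μ j * r j * - x)
      ≡⟨ ∑-distrib-+ (λ j → μ j * y j) (λ j → μ j * r j * - x) ⟩
    sum (λ j → μ j * y j) + sum (λ j → μ j * r j * - x)
      ≡⟨ cong (sum (λ j → μ j * y j) +_) (*-distribʳ-sum (- x) (λ j → μ j * r j)) ⟨
    sum (λ j → μ j * y j) + sum (λ j → μ j * r j) * - x
      ≡⟨ solve 3 (λ a s x → a :+ s :* (:- x) := :- s :* x :+ a) refl
                 (sum (λ j → μ j * y j)) (sum (λ j → μ j * r j)) x ⟩
    - sum (λ j → μ j * r j) * x + sum (λ j → μ j * y j) ∎
    where
    open ≡-Reasoning
    open +-*-Solver

  module Elimination {A : Set} {k} (u : Fin (suc k) → A → ℚ) (p : Fin (suc k)) (a₀ : A)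
    (pivot≢0 : u p a₀ ≢ 0ℚ) where

    instance
      _ : NonZero (u p a₀)
      _ = ≢-nonZero pivot≢0

    ratio : Fin k → ℚ
    ratio j = u (punchIn p j) a₀ * 1/ (u p a₀)

    eliminated : Fin k → A → ℚ
    eliminated j a = u (punchIn p j) a - ratio j * u p a

    eliminated-a₀ : ∀ j → eliminated j a₀ ≡ 0ℚ
    eliminated-a₀ j = begin
      y - y * 1/ x * x    ≡⟨ cong (λ t → y - t) (*-assoc y (1/ x) x) ⟩
      y - y * (1/ x * x)  ≡⟨ cong (λ t → y - y * t) (*-inverseˡ x) ⟩
      y - y * 1ℚ          ≡⟨ cong (λ t → y - t) (*-identityʳ y) ⟩
      y - y               ≡⟨ +-inverseʳ y ⟩
      0ℚ                  ∎
      where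
      open ≡-Reasoning
      x = u p a₀
      y = u (punchIn p j) a₀

    eliminated-independent : Independent u → Independent eliminated
    eliminated-independent indep μ comb≡0 j = begin
      μ j                ≡⟨ insertAt-punchIn μ p (- S) j ⟨
      λs (punchIn p j)   ≡⟨ indep λs (λ a → trans (lift a) (comb≡0 a)) (punchIn p j) ⟩
      0ℚ                 ∎
      where
      open ≡-Reasoning
      S = sum (λ j → μ j * ratio j)
      λs = insertAt μ p (- S)
      lift : ∀ a → sum (λ i → λs i * u i a) ≡ sum (λ j → μ j * eliminated j a)
      lift a = begin
        sum (λ i → λs i * u i a)
          ≡⟨ sum-remove (λ i → λs i * u i a) ⟩
        λs p * u p a + sum (λ j → λs (punchIn p j) * u (punchIn p j) a)
          ≡⟨ cong₂ _+_ (cong (_* u p a) (insertAt-lookup μ p (- S)))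
                       (sum-cong-≗ (λ j → cong (_* u (punchIn p j) a) (insertAt-punchIn μ p (- S) j))) ⟩
        - S * u p a + sum (λ j → μ j * u (punchIn p j) a)
          ≡⟨ sum-*-sub μ (λ j → u (punchIn p j) a) ratio (u p a) ⟨
        sum (λ j → μ j * eliminated j a) ∎

  independent⇒≤ : ∀ {m k} {u : Fin k → Fin m → ℚ} → Independent u → k ≤ m
  independent⇒≤ {k = zero} _ = z≤n
  independent⇒≤ {zero} {suc k} indep = ⊥-elim (1≢0 (indep (λ _ → 1ℚ) (λ ()) zero))
  independent⇒≤ {suc m} {suc k} {u} indep with any? (λ i → ¬? (u i zero ≟ 0ℚ))
  ... | yes (p , pivot≢0) =
    s≤s (independent⇒≤ (drop-zero-coordinate eliminated-a₀ (eliminated-independent indep)))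
    where open Elimination u p zero pivot≢0
  ... | no no-pivot =
    m≤n⇒m≤1+n (independent⇒≤ {u = λ i a → u i (suc a)} (drop-zero-coordinate {u = u} u₀≡0 indep))
    where
    u₀≡0 : ∀ i → u i zero ≡ 0ℚ
    u₀≡0 i = decidable-stable (u i zero ≟ 0ℚ) (λ u₀≢0 → no-pivot (i , u₀≢0))

  HasIndep-map : ∀ {n k} {C C′ : EVec n → Set} → (∀ {c} → C c → C′ c) → HasIndep C k → HasIndep C′ k
  HasIndep-map C⊆C′ (u , u∈C , indep) = u , C⊆C′ ∘ u∈C , indep

  Independent⇒≤numEdges : ∀ {n k} {u : Fin k → EVec n} → Independent u → k ≤ numEdges n
  Independent⇒≤numEdges indep = independent⇒≤ (Independent-reindex enum index enum-index indep)

  extend : ∀ {n k} {u : Fin k → EVec n} {v w : EVec n} → Independent u →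
    (∀ i → ⟨ u i , w ⟩ ≡ 0ℚ) → ⟨ v , w ⟩ ≢ 0ℚ → Independent (v ∷ u)
  extend {u = u} {v} {w} indep u⊥w v⊥̸w λs comb≡0 = λs≡0
    where
    open ≡-Reasoning
    tail⊥w : ∀ i → λs (suc i) * ⟨ u i , w ⟩ ≡ 0ℚ
    tail⊥w i = trans (cong (λs (suc i) *_) (u⊥w i)) (*-zeroʳ (λs (suc i)))
    λ₀≡0 : λs zero ≡ 0ℚ
    λ₀≡0 = x*y≡0⇒x≡0 (begin
      λs zero * ⟨ v , w ⟩
        ≡⟨ +-identityʳ _ ⟨
      λs zero * ⟨ v , w ⟩ + 0ℚ
        ≡⟨ cong (λs zero * ⟨ v , w ⟩ +_) (sum-zero tail⊥w) ⟨
      sum (λ i → λs i * ⟨ (v ∷ u) i , w ⟩)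
        ≡⟨ ⟨⟩-combˡ λs (v ∷ u) w ⟨
      ⟨ (λ e → sum (λ i → λs i * (v ∷ u) i e)) , w ⟩
        ≡⟨ Σᴱ-zero (λ e → trans (cong (_* w e) (comb≡0 e)) (*-zeroˡ (w e))) ⟩
      0ℚ ∎) v⊥̸w
    λs≡0 : ∀ i → λs i ≡ 0ℚ
    λs≡0 zero    = λ₀≡0
    λs≡0 (suc i) = indep (λ i → λs (suc i)) tail≡0 i
      where
      tail≡0 : ∀ e → sum (λ i → λs (suc i) * u i e) ≡ 0ℚ
      tail≡0 e = begin
        sum (λ i → λs (suc i) * u i e)                ≡⟨ +-identityˡ _ ⟨
        0ℚ + sum (λ i → λs (suc i) * u i e)           ≡⟨ cong (_+ sum (λ i → λs (suc i) * u i e))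
                                                            (trans (cong (_* v e) λ₀≡0) (*-zeroˡ (v e))) ⟨
        λs zero * v e + sum (λ i → λs (suc i) * u i e) ≡⟨ comb≡0 e ⟩
        0ℚ                                             ∎

  kernel-bound : ∀ {n k} {u : Fin k → EVec n} {w : EVec n} (g : Edge n) → Independent u →
    (∀ i → ⟨ u i , w ⟩ ≡ 0ℚ) → ⟨ δ g , w ⟩ ≢ 0ℚ → suc k ≤ numEdges n
  kernel-bound {u = u} g indep u⊥w δg⊥̸w = Independent⇒≤numEdges {u = δ g ∷ u} (extend indep u⊥w δg⊥̸w)

  module _ {A : Set} {k} (u : Fin k → A → ℚ) (pivot : Fin k → A) (rank : Fin k → ℕ)
    (u-pivot : ∀ i → u i (pivot i) ≡ 1ℚ)
    (u-below : ∀ i j → i ≢ j → rank j ≤ rank i → u i (pivot j) ≡ 0ℚ) where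

    unitriangular⇒Independent : Independent u
    unitriangular⇒Independent λs comb≡0 j = vanish (suc (rank j)) j (s≤s ≤-refl)
      where
      vanish : ∀ r j → rank j < r → λs j ≡ 0ℚ
      vanish (suc r) j (s≤s rank-j≤r) = begin
        λs j                                ≡⟨ *-identityʳ (λs j) ⟨
        λs j * 1ℚ                           ≡⟨ cong (λs j *_) (u-pivot j) ⟨
        λs j * u j (pivot j)                ≡⟨ sum-single j off ⟨
        sum (λ i → λs i * u i (pivot j))    ≡⟨ comb≡0 (pivot j) ⟩
        0ℚ                                  ∎
        where
        open ≡-Reasoning
        off : ∀ i → i ≢ j → λs i * u i (pivot j) ≡ 0ℚ
        off i i≢j with rank i <ℕ? rank j
        ... | yes ri<rj = trans (cong (_* u i (pivot j)) (vanish r i (<-≤-trans ri<rj rank-j≤r)))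
                                (*-zeroˡ (u i (pivot j)))
        ... | no ri≮rj  = trans (cong (λs i *_) (u-below i j i≢j (≮⇒≥ ri≮rj))) (*-zeroʳ (λs i))

module Cuts where

  open import Defs
  open Sums
  open Edges
  open EdgeSums
  open SubsetLookup using (lookup⇒∈∁)
  open import Data.Nat using (ℕ; suc)
  open import Data.Bool using (true; false; not; _∧_; _∨_; _xor_)
  open import Data.Bool.Properties using (xor-comm)
  open import Data.Fin using (Fin; zero; _<?_)
  open import Data.Fin.Subset using (Subset; ∁; _∩_; _∪_)
  open import Data.Vec using (_∷_; lookup)
  open import Data.Vec.Properties using (lookup-map; lookup-zipWith)
  open import Data.Rational using (ℚ; 0ℚ; _+_; _*_; _≤_; -_)
  open import Data.Rational.Properties
    using ( ≤-antisym; +-mono-≤; +-monoʳ-≤; +-identityˡ; +-identityʳ; +-assoc; +-inverseˡ; ≤ᵇ⇒≤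
          ; module ≤-Reasoning)
  open import Data.Product using (_,_; proj₁; proj₂)
  open import Relation.Binary.PropositionalEquality
  open import Relation.Nullary using (yes; no)

  private
    variable
      n : ℕ

  cutVec : Subset n → EVec n
  cutVec S e = toℚ (separates S e)

  cutVec-nonneg : (S : Subset n) → NonNeg (cutVec S)
  cutVec-nonneg S e = toℚ-nonneg (separates S e)

  -- The summand of cutValue is local to its where block; unifying against this type names it.
  summandOf : ∀ {x : ℚ} (t : Fin n → Fin n → ℚ) → x ≡ sumFin (λ i → sumFin (t i)) → Fin n → Fin n → ℚ
  summandOf t _ = t

  cutValue≡⟨⟩ : ∀ (c : EVec n) S → cutValue c S ≡ ⟨ c , cutVec S ⟩
  cutValue≡⟨⟩ c S = begin
    cutValue c S              ≡⟨ sumFin≡sum (λ i → sumFin (t i)) ⟩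
    sum (λ i → sumFin (t i))  ≡⟨ sum-cong-≗ (λ i → sumFin≡sum (t i)) ⟩
    sum (λ i → sum (t i))     ≡⟨ sum-cong-≗ (λ i → sum-cong-≗ (onEdge≡summand i)) ⟨
    ⟨ c , cutVec S ⟩          ∎
    where
    open ≡-Reasoning
    t = summandOf _ (refl {x = cutValue c S})
    onEdge≡summand : ∀ i j → onEdge (λ e → c e * cutVec S e) i j ≡ t i j
    onEdge≡summand i j with i <? j
    ... | yes _ = refl
    ... | no _  = refl

  zero∉ : ∀ {X : Subset (suc n)} → IsCut X → lookup X zero ≡ false
  zero∉ {X = _ ∷ _} (x₀≡false , _) = x₀≡false

  IsCut⇒ProperNonempty : ∀ {X : Subset (suc n)} → IsCut X → ProperNonempty X
  IsCut⇒ProperNonempty X-cut = proj₂ X-cut , zero , lookup⇒∈∁ (zero∉ X-cut)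

  Kmin-≤ : ∀ {X : Subset n} {c} → Kmin X c →
    ∀ Z → ProperNonempty Z → ⟨ c , cutVec X ⟩ ≤ ⟨ c , cutVec Z ⟩
  Kmin-≤ {X = X} {c} (_ , min) Z Z-cut = subst₂ _≤_ (cutValue≡⟨⟩ c X) (cutValue≡⟨⟩ c Z) (min Z Z-cut)

  Kmin-intro : ∀ {X : Subset n} {c} → NonNeg c →
    (∀ Z → ProperNonempty Z → ⟨ c , cutVec X ⟩ ≤ ⟨ c , cutVec Z ⟩) → Kmin X c
  Kmin-intro {X = X} {c} 0≤c min =
    0≤c , λ Z Z-cut → subst₂ _≤_ (sym (cutValue≡⟨⟩ c X)) (sym (cutValue≡⟨⟩ c Z)) (min Z Z-cut)

  ⟨⟩-cutVec-xor : ∀ (c : EVec n) {Z S : Subset n} {b} → (∀ v → lookup Z v ≡ lookup S v xor b) →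
    ⟨ c , cutVec Z ⟩ ≡ ⟨ c , cutVec S ⟩
  ⟨⟩-cutVec-xor c {Z} {S} Z≡S⊕b = ⟨⟩-congʳ c (λ e → cong toℚ (separates-xor {Z = Z} {S} Z≡S⊕b e))

  Kmin-∁ : ∀ {S : Subset n} {c} → Kmin (∁ S) c → Kmin S c
  Kmin-∁ {S = S} {c} K = Kmin-intro (proj₁ K) λ Z Z-cut →
    subst (_≤ ⟨ c , cutVec Z ⟩) (⟨⟩-cutVec-xor c {∁ S} {S} ∁S≡S⊕true) (Kmin-≤ K Z Z-cut)
    where
    ∁S≡S⊕true : ∀ v → lookup (∁ S) v ≡ lookup S v xor true
    ∁S≡S⊕true v = trans (lookup-map v not S) (xor-comm true (lookup S v))

  Kmin-tie : ∀ {X Y : Subset n} {c} → Kmin X c → Kmin Y c → ProperNonempty X → ProperNonempty Y →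
    ⟨ c , cutVec X ⟩ ≡ ⟨ c , cutVec Y ⟩
  Kmin-tie {X = X} {Y} KX KY X-cut Y-cut = ≤-antisym (Kmin-≤ KX Y Y-cut) (Kmin-≤ KY X X-cut)

  submodular : ∀ x y x′ y′ →
    toℚ ((x ∧ y) xor (x′ ∧ y′)) + toℚ ((x ∨ y) xor (x′ ∨ y′)) ≤ toℚ (x xor x′) + toℚ (y xor y′)
  submodular true  true  true  true  = ≤ᵇ⇒≤ _
  submodular true  true  true  false = ≤ᵇ⇒≤ _
  submodular true  true  false true  = ≤ᵇ⇒≤ _
  submodular true  true  false false = ≤ᵇ⇒≤ _
  submodular true  false true  true  = ≤ᵇ⇒≤ _
  submodular true  false true  false = ≤ᵇ⇒≤ _
  submodular true  false false true  = ≤ᵇ⇒≤ _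
  submodular true  false false false = ≤ᵇ⇒≤ _
  submodular false true  true  true  = ≤ᵇ⇒≤ _
  submodular false true  true  false = ≤ᵇ⇒≤ _
  submodular false true  false true  = ≤ᵇ⇒≤ _
  submodular false true  false false = ≤ᵇ⇒≤ _
  submodular false false true  true  = ≤ᵇ⇒≤ _
  submodular false false true  false = ≤ᵇ⇒≤ _
  submodular false false false true  = ≤ᵇ⇒≤ _
  submodular false false false false = ≤ᵇ⇒≤ _

  +-≤-cancel : ∀ {r x : ℚ} → r + x ≤ r → x ≤ 0ℚ
  +-≤-cancel {r} {x} r+x≤r = begin
    x              ≡⟨ +-identityˡ x ⟨
    0ℚ + x         ≡⟨ cong (_+ x) (+-inverseˡ r) ⟨
    - r + r + x    ≡⟨ +-assoc (- r) r x ⟩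
    - r + (r + x)  ≤⟨ +-monoʳ-≤ (- r) r+x≤r ⟩
    - r + r        ≡⟨ +-inverseˡ r ⟩
    0ℚ             ∎
    where open ≤-Reasoning

  -- Submodularity: an edge f from X ∖ Y to Y ∖ X counts in cut X + cut Y but not in
  -- cut (X ∩ Y) + cut (X ∪ Y), so minimality of X and Y leaves no room for weight on f.
  module _ {X Y : Subset n} {c : EVec n} (KX : Kmin X c) (KY : Kmin Y c)
    (∩-cut : ProperNonempty (X ∩ Y)) (∪-cut : ProperNonempty (X ∪ Y)) where

    crossing-edge-vanishes : ∀ {b d} (b≢d : b ≢ d) → lookup X b ≡ true → lookup Y b ≡ false →
      lookup X d ≡ false → lookup Y d ≡ true → c (edge b d b≢d) ≡ 0ℚ
    crossing-edge-vanishes {b} {d} b≢d Xb Yb Xd Yd = ≤-antisym c-f≤0 (proj₁ KX f)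
      where
      f = edge b d b≢d
      pointwise : ∀ e → cutVec (X ∩ Y) e + cutVec (X ∪ Y) e + (δ f e + δ f e) ≤ cutVec X e + cutVec Y e
      pointwise e with e ≟ᴱ f
      ... | yes refl
        rewrite separates-edge (X ∩ Y) b d b≢d | separates-edge (X ∪ Y) b d b≢d
              | separates-edge X b d b≢d | separates-edge Y b d b≢d
              | lookup-zipWith _∧_ b X Y | lookup-zipWith _∧_ d X Y
              | lookup-zipWith _∨_ b X Y | lookup-zipWith _∨_ d X Y | Xb | Yb | Xd | Yd = ≤ᵇ⇒≤ _
      ... | no _
        rewrite +-identityʳ (cutVec (X ∩ Y) e + cutVec (X ∪ Y) e)
              | lookup-zipWith _∧_ (src e) X Y | lookup-zipWith _∧_ (tgt e) X Y
              | lookup-zipWith _∨_ (src e) X Y | lookup-zipWith _∨_ (tgt e) X Y =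
        submodular (lookup X (src e)) (lookup Y (src e)) (lookup X (tgt e)) (lookup Y (tgt e))
      P = ⟨ c , cutVec (X ∩ Y) ⟩ + ⟨ c , cutVec (X ∪ Y) ⟩
      excess : P + (c f + c f) ≤ P
      excess = begin
        P + (c f + c f)
          ≡⟨ cong₂ (λ s t → P + (s + t)) ⟨ c ,δ⟩ ⟨ c ,δ⟩ ⟨
        P + (⟨ c , δ f ⟩ + ⟨ c , δ f ⟩)
          ≡⟨ cong₂ _+_ (⟨⟩-+ʳ c (cutVec (X ∩ Y)) (cutVec (X ∪ Y))) (⟨⟩-+ʳ c (δ f) (δ f)) ⟨
        ⟨ c , (λ e → cutVec (X ∩ Y) e + cutVec (X ∪ Y) e) ⟩ + ⟨ c , (λ e → δ f e + δ f e) ⟩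
          ≡⟨ ⟨⟩-+ʳ c _ _ ⟨
        ⟨ c , (λ e → cutVec (X ∩ Y) e + cutVec (X ∪ Y) e + (δ f e + δ f e)) ⟩
          ≤⟨ ⟨⟩-monoʳ-≤ (proj₁ KX) pointwise ⟩
        ⟨ c , (λ e → cutVec X e + cutVec Y e) ⟩
          ≡⟨ ⟨⟩-+ʳ c (cutVec X) (cutVec Y) ⟩
        ⟨ c , cutVec X ⟩ + ⟨ c , cutVec Y ⟩
          ≤⟨ +-mono-≤ (Kmin-≤ KX (X ∩ Y) ∩-cut) (Kmin-≤ KY (X ∪ Y) ∪-cut) ⟩
        P ∎
        where open ≤-Reasoning
      c-f≤0 : c f ≤ 0ℚ
      c-f≤0 = begin
        c f           ≡⟨ +-identityʳ (c f) ⟨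
        c f + 0ℚ      ≤⟨ +-monoʳ-≤ (c f) (proj₁ KX f) ⟩
        c f + c f     ≤⟨ +-≤-cancel excess ⟩
        0ℚ            ∎
        where open ≤-Reasoning

module NestedFamily where

  open import Defs
  open Edges
  open EdgeSums
  open EdgeCount using (edgesBut; edgesBut-≢; edgesBut-injective)
  open Independence
  open Cuts
  open SubsetLookup
  open import Data.Nat using (ℕ; _∸_; z≤n; s≤s) renaming (_≤_ to _≤ℕ_)
  import Data.Nat.Properties as ℕ
  open import Data.Bool using (Bool; true; false; not; _∧_; _∨_; _xor_; if_then_else_)
  open import Data.Bool.Properties using (¬-not; xor-inverseˡ; xor-same; ∨-zeroʳ) renaming (_≟_ to _≟ᴮ_)
  open import Data.Fin using (Fin)
  open import Data.Fin.Properties using (all?; ¬∀⟶∃¬)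
  open import Data.Fin.Subset using (Subset; ∁; _∩_)
  open import Data.Vec using (lookup)
  open import Data.Vec.Properties using (lookup-map; lookup-zipWith)
  open import Data.Rational using (ℚ; 0ℚ; 1ℚ; _+_; _*_; _≤_; nonNegative)
  open import Data.Rational.Properties
    using ( ≤-reflexive; ≤-trans; +-mono-≤; +-monoˡ-≤; +-monoʳ-≤; *-monoˡ-≤-nonNeg; +-identityˡ; +-identityʳ
          ; *-zeroˡ; *-zeroʳ; *-identityʳ; module ≤-Reasoning)
  open import Data.Rational.Solver using (module +-*-Solver)
  open import Data.Product using (_×_; _,_; proj₁; proj₂)
  open import Function using (_∘_)
  open import Relation.Binary.PropositionalEquality
  open import Relation.Nullary using (yes; no)
  open import Data.Empty using (⊥-elim)

  -- A ⊆ B splits the vertices into the classes A, Q = B ∖ A and ∁ B, represented by a, m and z.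
  module ThreeClasses {n} {A B : Subset n} (A⊆B : ∀ v → lookup A v ≡ true → lookup B v ≡ true)
    {a m z : Fin n} (Aa : lookup A a ≡ true) (Am : lookup A m ≡ false) (Bm : lookup B m ≡ true)
    (Bz : lookup B z ≡ false) where

    Ba : lookup B a ≡ true
    Ba = A⊆B a Aa

    Az : lookup A z ≡ false
    Az = ¬-not (λ Az≡true → true≢false (trans (sym (A⊆B z Az≡true)) Bz))

    Q : Subset n
    Q = B ∩ ∁ A

    lookup-Q : ∀ v → lookup Q v ≡ lookup B v ∧ not (lookup A v)
    lookup-Q v = trans (lookup-zipWith _∧_ v B (∁ A)) (cong (lookup B v ∧_) (lookup-map v not A))

    Qa : lookup Q a ≡ false
    Qa = trans (lookup-Q a) (cong₂ (λ x y → x ∧ not y) Ba Aa)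

    Qm : lookup Q m ≡ true
    Qm = trans (lookup-Q m) (cong₂ (λ x y → x ∧ not y) Bm Am)

    Qz : lookup Q z ≡ false
    Qz = trans (lookup-Q z) (cong (_∧ not (lookup A z)) Bz)

    rep : Fin n → Fin n
    rep v with lookup A v | lookup B v
    ... | true  | _     = a
    ... | false | true  = m
    ... | false | false = z

    rep-elim : ∀ (P : Fin n → Set) → P a → P m → P z → ∀ v → P (rep v)
    rep-elim P Pa Pm Pz v with lookup A v | lookup B v
    ... | true  | _     = Pa
    ... | false | true  = Pm
    ... | false | false = Pz

    rep-A : ∀ v → lookup A (rep v) ≡ lookup A v
    rep-A v with lookup A v | lookup B v
    ... | true  | _     = Aa
    ... | false | true  = Am
    ... | false | false = Az

    rep-B : ∀ v → lookup B (rep v) ≡ lookup B v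
    rep-B v with lookup A v in Av | lookup B v in Bv
    ... | true  | true  = Ba
    ... | true  | false = ⊥-elim (true≢false (trans (sym (A⊆B v Av)) Bv))
    ... | false | true  = Bm
    ... | false | false = Bz

    rep-Q : ∀ v → lookup Q (rep v) ≡ lookup Q v
    rep-Q v rewrite lookup-Q (rep v) | lookup-Q v | rep-A v | rep-B v = refl

    -- A cut through no edge inside a class has the cut vector of A, B or Q.
    module _ {c : EVec n} (0≤c : NonNeg c) (A≡B : ⟨ c , cutVec A ⟩ ≡ ⟨ c , cutVec B ⟩)
      (A≤Q : ⟨ c , cutVec A ⟩ ≤ ⟨ c , cutVec Q ⟩)
      (A≤inside : ∀ e → separates A e ≡ false → separates B e ≡ false → ⟨ c , cutVec A ⟩ ≤ c e) where

      module _ (Z : Subset n) (classwise : ∀ v → lookup Z v ≡ lookup Z (rep v)) where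

        private
          b = lookup Z z

        agrees : ∀ {s x} → s ≡ false → lookup Z x ≡ b → lookup Z x ≡ s xor b
        agrees s≡false Zx≡b = trans Zx≡b (cong (_xor b) (sym s≡false))

        differs : ∀ {s x} → s ≡ true → lookup Z x ≢ b → lookup Z x ≡ s xor b
        differs s≡true Zx≢b = trans (¬-not Zx≢b) (cong (_xor b) (sym s≡true))

        cut-as : ∀ S → (∀ v → lookup S (rep v) ≡ lookup S v) → lookup S z ≡ false →
          lookup Z a ≡ lookup S a xor b → lookup Z m ≡ lookup S m xor b →
          ⟨ c , cutVec Z ⟩ ≡ ⟨ c , cutVec S ⟩
        cut-as S S-rep Sz Za Zm = ⟨⟩-cutVec-xor c {Z} {S} Z≡S⊕b
          where
          Z≡S⊕b : ∀ v → lookup Z v ≡ lookup S v xor b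
          Z≡S⊕b v = begin
            lookup Z v              ≡⟨ classwise v ⟩
            lookup Z (rep v)        ≡⟨ rep-elim (λ r → lookup Z r ≡ lookup S r xor b) Za Zm (agrees Sz refl) v ⟩
            lookup S (rep v) xor b  ≡⟨ cong (_xor b) (S-rep v) ⟩
            lookup S v xor b        ∎
            where open ≡-Reasoning

        classwise-min : ProperNonempty Z → ⟨ c , cutVec A ⟩ ≤ ⟨ c , cutVec Z ⟩
        classwise-min ((u , u∈Z) , (w , w∈∁Z)) with lookup Z a ≟ᴮ b | lookup Z m ≟ᴮ b
        ... | no Za≢b  | yes Zm≡b =
          ≤-reflexive (sym (cut-as A rep-A Az (differs Aa Za≢b) (agrees Am Zm≡b)))
        ... | no Za≢b  | no Zm≢b  =
          ≤-reflexive (trans A≡B (sym (cut-as B rep-B Bz (differs Ba Za≢b) (differs Bm Zm≢b))))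
        ... | yes Za≡b | no Zm≢b  =
          ≤-trans A≤Q (≤-reflexive (sym (cut-as Q rep-Q Qz (agrees Qa Za≡b) (differs Qm Zm≢b))))
        ... | yes Za≡b | yes Zm≡b = ⊥-elim (true≢false (begin
          true        ≡⟨ ∈⇒lookup u∈Z ⟨
          lookup Z u  ≡⟨ constant u ⟩
          b           ≡⟨ constant w ⟨
          lookup Z w  ≡⟨ ∈∁⇒lookup w∈∁Z ⟩
          false       ∎))
          where
          open ≡-Reasoning
          constant : ∀ v → lookup Z v ≡ b
          constant v = trans (classwise v) (rep-elim (λ r → lookup Z r ≡ b) Za≡b Zm≡b refl v)

      inside-edge-min : ∀ Z v → lookup Z v ≢ lookup Z (rep v) → ⟨ c , cutVec A ⟩ ≤ ⟨ c , cutVec Z ⟩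
      inside-edge-min Z v Zv≢Zrv = begin
        ⟨ c , cutVec A ⟩  ≤⟨ A≤inside f (sep-f A (rep-A v)) (sep-f B (rep-B v)) ⟩
        c f               ≡⟨ *-identityʳ (c f) ⟨
        c f * 1ℚ          ≡⟨ cong (λ b → c f * toℚ b) Z-sep-f ⟨
        c f * cutVec Z f  ≤⟨ ≤-⟨⟩ 0≤c (cutVec-nonneg Z) f ⟩
        ⟨ c , cutVec Z ⟩  ∎
        where
        open ≤-Reasoning
        f = edge v (rep v) (Zv≢Zrv ∘ cong (lookup Z))
        sep-f : ∀ S → lookup S (rep v) ≡ lookup S v → separates S f ≡ false
        sep-f S Srv≡Sv =
          trans (separates-edge S v (rep v) _) (trans (cong (lookup S v xor_) Srv≡Sv) (xor-same (lookup S v)))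
        Z-sep-f : separates Z f ≡ true
        Z-sep-f = trans (separates-edge Z v (rep v) _)
          (trans (cong (_xor lookup Z (rep v)) (¬-not Zv≢Zrv)) (xor-inverseˡ (lookup Z (rep v))))

      three-class-min : ∀ Z → ProperNonempty Z → ⟨ c , cutVec A ⟩ ≤ ⟨ c , cutVec Z ⟩
      three-class-min Z Z-cut with all? (λ v → lookup Z v ≟ᴮ lookup Z (rep v))
      ... | yes classwise = classwise-min Z classwise Z-cut
      ... | no ¬classwise = inside-edge-min Z v Zv≢Zrv
        where
        v = proj₁ (¬∀⟶∃¬ n _ (λ v → lookup Z v ≟ᴮ lookup Z (rep v)) ¬classwise)
        Zv≢Zrv = proj₂ (¬∀⟶∃¬ n _ (λ v → lookup Z v ≟ᴮ lookup Z (rep v)) ¬classwise)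

    a≢m : a ≢ m
    a≢m a≡m = true≢false (trans (sym Aa) (trans (cong (lookup A) a≡m) Am))

    m≢z : m ≢ z
    m≢z m≡z = true≢false (trans (sym Bm) (trans (cong (lookup B) m≡z) Bz))

    g₀ k₀ : Edge n
    g₀ = edge m z m≢z
    k₀ = edge a m a≢m

    A-g₀ : separates A g₀ ≡ false
    A-g₀ = trans (separates-edge A m z m≢z) (cong₂ _xor_ Am Az)

    B-g₀ : separates B g₀ ≡ true
    B-g₀ = trans (separates-edge B m z m≢z) (cong₂ _xor_ Bm Bz)

    Q-g₀ : separates Q g₀ ≡ true
    Q-g₀ = trans (separates-edge Q m z m≢z) (cong₂ _xor_ Qm Qz)

    A-k₀ : separates A k₀ ≡ true
    A-k₀ = trans (separates-edge A a m a≢m) (cong₂ _xor_ Aa Am)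

    B-k₀ : separates B k₀ ≡ false
    B-k₀ = trans (separates-edge B a m a≢m) (cong₂ _xor_ Ba Bm)

    Q-k₀ : separates Q k₀ ≡ true
    Q-k₀ = trans (separates-edge Q a m a≢m) (cong₂ _xor_ Qa Qm)

    crossing : Edge n → Bool
    crossing e = separates A e ∨ separates B e

    crossing-A : ∀ e → separates A e ≡ true → crossing e ≡ true
    crossing-A e sAe = cong (_∨ separates B e) sAe

    crossing-B : ∀ e → separates B e ≡ true → crossing e ≡ true
    crossing-B e sBe = trans (cong (separates A e ∨_) sBe) (∨-zeroʳ (separates A e))

    inside : EVec n
    inside e = toℚ (not (crossing e))

    balance : Edge n → EVec n
    balance g f = inside f + δ g f

    -- If A separates e, weight on g₀ (separated by B only) restores cut A = cut B, and dually k₀ if B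
    -- does; weight 1 on every edge inside a class makes all other cuts at least as expensive.
    ray : Edge n → EVec n
    ray e f = δ e f + (cutVec A e * balance g₀ f + cutVec B e * balance k₀ f)

    τ : Edge n → ℚ
    τ e = cutVec A e + cutVec B e

    inside-nonneg : NonNeg inside
    inside-nonneg e = toℚ-nonneg (not (crossing e))

    balance-nonneg : ∀ g → NonNeg (balance g)
    balance-nonneg g f = +-mono-≤ (inside-nonneg f) (δ-nonneg g f)

    ray-nonneg : ∀ e → NonNeg (ray e)
    ray-nonneg e f = +-mono-≤ (δ-nonneg e f) (+-mono-≤ (*-nonneg (cutVec-nonneg A e) (balance-nonneg g₀ f))
                                                      (*-nonneg (cutVec-nonneg B e) (balance-nonneg k₀ f)))

    inside⊥cutVec : ∀ S → (∀ e → separates S e ≡ true → crossing e ≡ true) →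
      ⟨ inside , cutVec S ⟩ ≡ 0ℚ
    inside⊥cutVec S S-crossing = Σᴱ-zero vanish
      where
      vanish : ∀ e → inside e * cutVec S e ≡ 0ℚ
      vanish e with separates S e in Se
      ... | true rewrite S-crossing e Se = refl
      ... | false = *-zeroʳ (inside e)

    ⟨balance_,_⟩ : ∀ g w → ⟨ balance g , w ⟩ ≡ ⟨ inside , w ⟩ + w g
    ⟨balance g , w ⟩ = trans (⟨⟩-+ˡ inside (δ g) w) (cong (⟨ inside , w ⟩ +_) ⟨δ, w ⟩)

    ⟨ray_,_⟩ : ∀ e w →
      ⟨ ray e , w ⟩ ≡ w e + (cutVec A e * ⟨ balance g₀ , w ⟩ + cutVec B e * ⟨ balance k₀ , w ⟩)
    ⟨ray e , w ⟩ = begin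
      ⟨ ray e , w ⟩
        ≡⟨ ⟨⟩-+ˡ (δ e) (λ f → α * balance g₀ f + β * balance k₀ f) w ⟩
      ⟨ δ e , w ⟩ + ⟨ (λ f → α * balance g₀ f + β * balance k₀ f) , w ⟩
        ≡⟨ cong₂ _+_ ⟨δ, w ⟩ (⟨⟩-+ˡ (λ f → α * balance g₀ f) (λ f → β * balance k₀ f) w) ⟩
      w e + (⟨ (λ f → α * balance g₀ f) , w ⟩ + ⟨ (λ f → β * balance k₀ f) , w ⟩)
        ≡⟨ cong (w e +_) (cong₂ _+_ (⟨⟩-scaleˡ α (balance g₀) w) (⟨⟩-scaleˡ β (balance k₀) w)) ⟩
      w e + (α * ⟨ balance g₀ , w ⟩ + β * ⟨ balance k₀ , w ⟩) ∎
      where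
      open ≡-Reasoning
      α = cutVec A e
      β = cutVec B e

    ray-cut : ∀ S → (∀ e → separates S e ≡ true → crossing e ≡ true) → ∀ e →
      ⟨ ray e , cutVec S ⟩ ≡ cutVec S e + (cutVec A e * cutVec S g₀ + cutVec B e * cutVec S k₀)
    ray-cut S S-crossing e = trans ⟨ray e , cutVec S ⟩
      (cong₂ (λ x y → cutVec S e + (cutVec A e * x + cutVec B e * y)) (balance-cut g₀) (balance-cut k₀))
      where
      balance-cut : ∀ g → ⟨ balance g , cutVec S ⟩ ≡ cutVec S g
      balance-cut g = trans ⟨balance g , cutVec S ⟩
        (trans (cong (_+ cutVec S g) (inside⊥cutVec S S-crossing)) (+-identityˡ (cutVec S g)))

    ray-A : ∀ e → ⟨ ray e , cutVec A ⟩ ≡ τ e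
    ray-A e = begin
      ⟨ ray e , cutVec A ⟩
        ≡⟨ ray-cut A crossing-A e ⟩
      α + (α * cutVec A g₀ + β * cutVec A k₀)
        ≡⟨ cong₂ (λ x y → α + (α * toℚ x + β * toℚ y)) A-g₀ A-k₀ ⟩
      α + (α * 0ℚ + β * 1ℚ)
        ≡⟨ solve 2 (λ α β → α :+ (α :* con 0ℚ :+ β :* con 1ℚ) := α :+ β) refl α β ⟩
      τ e ∎
      where
      open ≡-Reasoning
      open +-*-Solver
      α = cutVec A e
      β = cutVec B e

    ray-B : ∀ e → ⟨ ray e , cutVec B ⟩ ≡ τ e
    ray-B e = begin
      ⟨ ray e , cutVec B ⟩
        ≡⟨ ray-cut B crossing-B e ⟩
      β + (α * cutVec B g₀ + β * cutVec B k₀)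
        ≡⟨ cong₂ (λ x y → β + (α * toℚ x + β * toℚ y)) B-g₀ B-k₀ ⟩
      β + (α * 1ℚ + β * 0ℚ)
        ≡⟨ solve 2 (λ α β → β :+ (α :* con 1ℚ :+ β :* con 0ℚ) := α :+ β) refl α β ⟩
      τ e ∎
      where
      open ≡-Reasoning
      open +-*-Solver
      α = cutVec A e
      β = cutVec B e

    τ-≤ : ∀ e {s x y} → 0ℚ ≤ s → 1ℚ ≤ x → 1ℚ ≤ y → τ e ≤ s + (cutVec A e * x + cutVec B e * y)
    τ-≤ e {s} {x} {y} 0≤s 1≤x 1≤y = begin
      α + β
        ≡⟨ solve 2 (λ α β → α :+ β := con 0ℚ :+ (α :* con 1ℚ :+ β :* con 1ℚ)) refl α β ⟩
      0ℚ + (α * 1ℚ + β * 1ℚ)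
        ≤⟨ +-mono-≤ 0≤s (+-mono-≤ (*-monoˡ-≤-nonNeg α {{nonNegative (cutVec-nonneg A e)}} 1≤x)
                                  (*-monoˡ-≤-nonNeg β {{nonNegative (cutVec-nonneg B e)}} 1≤y)) ⟩
      s + (α * x + β * y) ∎
      where
      open ≤-Reasoning
      open +-*-Solver
      α = cutVec A e
      β = cutVec B e

    1≤⟨balance⟩ : ∀ g S → separates S g ≡ true → 1ℚ ≤ ⟨ balance g , cutVec S ⟩
    1≤⟨balance⟩ g S Sg = begin
      1ℚ                                  ≡⟨ +-identityˡ 1ℚ ⟨
      0ℚ + 1ℚ                             ≤⟨ +-monoˡ-≤ 1ℚ (⟨⟩-nonneg inside-nonneg (cutVec-nonneg S)) ⟩
      ⟨ inside , cutVec S ⟩ + 1ℚ          ≡⟨ cong (λ b → ⟨ inside , cutVec S ⟩ + toℚ b) Sg ⟨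
      ⟨ inside , cutVec S ⟩ + cutVec S g  ≡⟨ ⟨balance g , cutVec S ⟩ ⟨
      ⟨ balance g , cutVec S ⟩            ∎
      where open ≤-Reasoning

    ray-Q : ∀ e → τ e ≤ ⟨ ray e , cutVec Q ⟩
    ray-Q e = ≤-trans (τ-≤ e (cutVec-nonneg Q e) (1≤⟨balance⟩ g₀ Q Q-g₀) (1≤⟨balance⟩ k₀ Q Q-k₀))
                      (≤-reflexive (sym ⟨ray e , cutVec Q ⟩))

    ray-inside : ∀ e f → separates A f ≡ false → separates B f ≡ false → τ e ≤ ray e f
    ray-inside e f Af Bf = τ-≤ e (δ-nonneg e f) (1≤balance g₀) (1≤balance k₀)
      where
      1≤balance : ∀ g → 1ℚ ≤ balance g f
      1≤balance g = subst (λ t → 1ℚ ≤ toℚ (not t) + δ g f) (sym (cong₂ _∨_ Af Bf))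
        (≤-trans (≤-reflexive (sym (+-identityʳ 1ℚ))) (+-monoʳ-≤ 1ℚ (δ-nonneg g f)))

    ray∈cones : ∀ e → Kmin A (ray e) × Kmin B (ray e)
    ray∈cones e = Kmin-intro (ray-nonneg e) A-min , Kmin-intro (ray-nonneg e) B-min
      where
      A≡B = trans (ray-A e) (sym (ray-B e))
      A-min = three-class-min (ray-nonneg e) A≡B (≤-trans (≤-reflexive (ray-A e)) (ray-Q e))
                              (λ f Af Bf → ≤-trans (≤-reflexive (ray-A e)) (ray-inside e f Af Bf))
      B-min = λ Z Z-cut → subst (_≤ ⟨ ray e , cutVec Z ⟩) A≡B (A-min Z Z-cut)

    -- Off the diagonal, ray e only touches g₀, k₀ and edges inside a class; ranking edges separated
    -- by A below those separated by B only, below inside edges, makes the family unitriangular.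
    rank : Edge n → ℕ
    rank e = if separates A e then 0 else if separates B e then 1 else 2

    rank-A : ∀ e → separates A e ≡ true → rank e ≡ 0
    rank-A e Ae rewrite Ae = refl

    rank-B : ∀ e → separates B e ≡ true → rank e ≤ℕ 1
    rank-B e Be with separates A e
    ... | true  = z≤n
    ... | false rewrite Be = s≤s z≤n

    rank≤0 : ∀ f → rank f ≤ℕ 0 → separates A f ≡ true
    rank≤0 f rf≤0 with separates A f | separates B f | rf≤0
    ... | true  | _     | _  = refl
    ... | false | true  | ()
    ... | false | false | ()

    rank≤1 : ∀ f → rank f ≤ℕ 1 → crossing f ≡ true
    rank≤1 f rf≤1 with separates A f | separates B f | rf≤1
    ... | true  | _     | _     = refl
    ... | false | true  | _     = refl
    ... | false | false | s≤s ()

    toℚ-*-vanish : ∀ b {x} → (b ≡ true → x ≡ 0ℚ) → toℚ b * x ≡ 0ℚ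
    toℚ-*-vanish true  x≡0 = cong (1ℚ *_) (x≡0 refl)
    toℚ-*-vanish false {x} _ = *-zeroˡ x

    balance-vanish : ∀ {g f} → crossing f ≡ true → f ≢ g → balance g f ≡ 0ℚ
    balance-vanish crossing-f f≢g = cong₂ _+_ (cong (toℚ ∘ not) crossing-f) (δ-other f≢g)

    A-separated⇒≢g₀ : ∀ {f} → separates A f ≡ true → f ≢ g₀
    A-separated⇒≢g₀ Af refl = true≢false (trans (sym Af) A-g₀)

    ray-diag : ∀ e → e ≢ k₀ → ray e e ≡ 1ℚ
    ray-diag e e≢k₀ = begin
      δ e e + (cutVec A e * balance g₀ e + cutVec B e * balance k₀ e)
        ≡⟨ cong₂ (λ s t → s + (t + cutVec B e * balance k₀ e)) (δ-same e)
                 (toℚ-*-vanish (separates A e) A-term) ⟩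
      1ℚ + (0ℚ + cutVec B e * balance k₀ e)
        ≡⟨ cong (λ t → 1ℚ + (0ℚ + t)) (toℚ-*-vanish (separates B e) B-term) ⟩
      1ℚ ∎
      where
      open ≡-Reasoning
      A-term : separates A e ≡ true → balance g₀ e ≡ 0ℚ
      A-term Ae = balance-vanish (crossing-A e Ae) (A-separated⇒≢g₀ Ae)
      B-term : separates B e ≡ true → balance k₀ e ≡ 0ℚ
      B-term Be = balance-vanish (crossing-B e Be) e≢k₀

    ray-below : ∀ e f → e ≢ f → f ≢ k₀ → rank f ≤ℕ rank e → ray e f ≡ 0ℚ
    ray-below e f e≢f f≢k₀ rf≤re = begin
      δ e f + (cutVec A e * balance g₀ f + cutVec B e * balance k₀ f)
        ≡⟨ cong₂ (λ s t → s + (t + cutVec B e * balance k₀ f)) (δ-other (e≢f ∘ sym))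
                 (toℚ-*-vanish (separates A e) A-term) ⟩
      0ℚ + (0ℚ + cutVec B e * balance k₀ f)
        ≡⟨ cong (λ t → 0ℚ + (0ℚ + t)) (toℚ-*-vanish (separates B e) B-term) ⟩
      0ℚ ∎
      where
      open ≡-Reasoning
      A-term : separates A e ≡ true → balance g₀ f ≡ 0ℚ
      A-term Ae = balance-vanish (crossing-A f Af) (A-separated⇒≢g₀ Af)
        where Af = rank≤0 f (subst (rank f ≤ℕ_) (rank-A e Ae) rf≤re)
      B-term : separates B e ≡ true → balance k₀ f ≡ 0ℚ
      B-term Be = balance-vanish (rank≤1 f (ℕ.≤-trans rf≤re (rank-B e Be))) f≢k₀

    nested-family : HasIndep (λ c → Kmin A c × Kmin B c) (numEdges n ∸ 1)
    nested-family = ray ∘ E , ray∈cones ∘ E , Independent⇒LinIndep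
      (unitriangular⇒Independent (ray ∘ E) E (rank ∘ E) (λ j → ray-diag (E j) (edgesBut-≢ k₀ j))
        (λ i j i≢j → ray-below (E i) (E j) (i≢j ∘ edgesBut-injective k₀) (edgesBut-≢ k₀ j)))
      where
      E = edgesBut k₀

module Adjacency where

  open import Defs
  open Edges
  open EdgeSums
  open Independence
  open Cuts
  open SubsetLookup
  open NestedFamily using (module ThreeClasses)
  open import Data.Nat using (ℕ; zero; suc; _∸_; s≤s) renaming (_≤_ to _≤ℕ_)
  open import Data.Nat.Properties using (n≮n)
  open import Data.Bool using (Bool; true; false; not; _∧_; _∨_; _xor_)
  open import Data.Bool.Properties using (¬-not; xor-identityʳ) renaming (_≟_ to _≟ᴮ_)
  open import Data.Fin using (zero; suc)
  open import Data.Fin.Properties using (any?)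
  open import Data.Fin.Subset using (Subset; ∁; _∩_; _∪_)
  open import Data.Vec using (lookup)
  open import Data.Vec.Properties using (lookup-map; lookup-zipWith)
  open import Data.Vec.Functional using (_∷_)
  open import Data.Rational using (0ℚ; _-_)
  open import Data.Rational.Properties using (+-inverseʳ)
  open import Data.Product using (_×_; _,_; proj₁; proj₂; ∃)
  open import Function using (_∘_)
  open import Function.Bundles using (_⇔_; mk⇔)
  open import Relation.Binary.PropositionalEquality
  open import Relation.Nullary using (¬_; Dec; yes; no)
  open import Relation.Nullary.Decidable using (_×-dec_)
  open import Data.Empty using (⊥-elim)

  private
    variable
      n : ℕ

  Atom : Subset n → Subset n → Bool → Bool → Set
  Atom X Y x y = ∃ λ v → lookup X v ≡ x × lookup Y v ≡ y

  atom? : ∀ (X Y : Subset n) x y → Dec (Atom X Y x y)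
  atom? X Y x y = any? (λ v → (lookup X v ≟ᴮ x) ×-dec (lookup Y v ≟ᴮ y))

  -- For cuts the fourth atom, outside X and Y, always contains vertex 0.
  Crossing : Subset n → Subset n → Set
  Crossing X Y = Atom X Y true true × Atom X Y true false × Atom X Y false true

  crossing? : ∀ (X Y : Subset n) → Dec (Crossing X Y)
  crossing? X Y = atom? X Y true true ×-dec atom? X Y true false ×-dec atom? X Y false true

  d∸1+2≰d : ∀ d → ¬ (suc (suc (d ∸ 1)) ≤ℕ d)
  d∸1+2≰d zero    ()
  d∸1+2≰d (suc d) (s≤s d<d) = n≮n d d<d

  toℚ-≢ : ∀ {x y} → x ≢ y → toℚ x - toℚ y ≢ 0ℚ
  toℚ-≢ {true}  {true}  x≢y = ⊥-elim (x≢y refl)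
  toℚ-≢ {true}  {false} _   = λ ()
  toℚ-≢ {false} {true}  _   = λ ()
  toℚ-≢ {false} {false} x≢y = ⊥-elim (x≢y refl)

  module _ {X Y : Subset (suc n)} (X-cut : IsCut X) (Y-cut : IsCut Y) where

    private
      C : EVec (suc n) → Set
      C c = Kmin X c × Kmin Y c

      d = numEdges (suc n)

      X₀ = zero∉ X-cut
      Y₀ = zero∉ Y-cut

    cutDiff : EVec (suc n)
    cutDiff e = cutVec X e - cutVec Y e

    cones⊆ker : ∀ {c} → C c → ⟨ c , cutDiff ⟩ ≡ 0ℚ
    cones⊆ker {c} (KX , KY) = begin
      ⟨ c , cutDiff ⟩                      ≡⟨ ⟨⟩-−ʳ c (cutVec X) (cutVec Y) ⟩
      ⟨ c , cutVec X ⟩ - ⟨ c , cutVec Y ⟩  ≡⟨ cong (_- ⟨ c , cutVec Y ⟩) X≡Y ⟩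
      ⟨ c , cutVec Y ⟩ - ⟨ c , cutVec Y ⟩  ≡⟨ +-inverseʳ ⟨ c , cutVec Y ⟩ ⟩
      0ℚ                                   ∎
      where
      open ≡-Reasoning
      X≡Y = Kmin-tie KX KY (IsCut⇒ProperNonempty X-cut) (IsCut⇒ProperNonempty Y-cut)

    separating-edge : X ≢ Y → ∃ λ g → ⟨ δ g , cutDiff ⟩ ≢ 0ℚ
    separating-edge X≢Y = g , λ ⟨δg,w⟩≡0 → toℚ-≢ sep-differ (trans (sym ⟨δ, cutDiff ⟩) ⟨δg,w⟩≡0)
      where
      v = proj₁ (differing-vertex X≢Y)
      Xv≢Yv = proj₂ (differing-vertex X≢Y)
      v≢0 : v ≢ zero
      v≢0 v≡0 = Xv≢Yv (trans (cong (lookup X) v≡0) (trans X₀ (sym (trans (cong (lookup Y) v≡0) Y₀))))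
      g = edge v zero v≢0
      separates-g : ∀ S → lookup S zero ≡ false → separates S g ≡ lookup S v
      separates-g S S₀ =
        trans (separates-edge S v zero v≢0) (trans (cong (lookup S v xor_) S₀) (xor-identityʳ (lookup S v)))
      sep-differ : separates X g ≢ separates Y g
      sep-differ eq = Xv≢Yv (trans (sym (separates-g X X₀)) (trans eq (separates-g Y Y₀)))

    distinct⇒¬HasIndep : X ≢ Y → ¬ HasIndep C (suc (d ∸ 1))
    distinct⇒¬HasIndep X≢Y (u , u∈C , indep) =
      d∸1+2≰d d (kernel-bound {u = u} g (LinIndep⇒Independent {u = u} indep) (cones⊆ker ∘ u∈C) δg⊥̸w)
      where
      g = proj₁ (separating-edge X≢Y)
      δg⊥̸w = proj₂ (separating-edge X≢Y)

    -- The edge f from X ∖ Y to Y ∖ X is a second independent constraint: both cuts separate f.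
    crossing⇒¬HasIndep : X ≢ Y → Crossing X Y → ¬ HasIndep C (d ∸ 1)
    crossing⇒¬HasIndep X≢Y ((a , Xa , Ya) , (b , Xb , Yb) , (b′ , Xb′ , Yb′)) (u , u∈C , indep) =
      d∸1+2≰d d (kernel-bound {u = δ f ∷ u} g δf∷u-indep δf∷u⊥w δg⊥̸w)
      where
      g = proj₁ (separating-edge X≢Y)
      δg⊥̸w = proj₂ (separating-edge X≢Y)
      b≢b′ : b ≢ b′
      b≢b′ b≡b′ = true≢false (trans (sym Xb) (trans (cong (lookup X) b≡b′) Xb′))
      f = edge b b′ b≢b′
      ∩-cut : ProperNonempty (X ∩ Y)
      ∩-cut = (a , lookup⇒∈ (trans (lookup-zipWith _∧_ a X Y) (cong₂ _∧_ Xa Ya)))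
            , (zero , lookup⇒∈∁ (trans (lookup-zipWith _∧_ zero X Y) (cong₂ _∧_ X₀ Y₀)))
      ∪-cut : ProperNonempty (X ∪ Y)
      ∪-cut = (a , lookup⇒∈ (trans (lookup-zipWith _∨_ a X Y) (cong₂ _∨_ Xa Ya)))
            , (zero , lookup⇒∈∁ (trans (lookup-zipWith _∨_ zero X Y) (cong₂ _∨_ X₀ Y₀)))
      u⊥δf : ∀ i → ⟨ u i , δ f ⟩ ≡ 0ℚ
      u⊥δf i = trans ⟨ u i ,δ⟩
        (crossing-edge-vanishes (proj₁ (u∈C i)) (proj₂ (u∈C i)) ∩-cut ∪-cut b≢b′ Xb Yb Xb′ Yb′)
      δf⊥̸δf : ⟨ δ f , δ f ⟩ ≢ 0ℚ
      δf⊥̸δf ⟨δf,δf⟩≡0 with () ← trans (sym (trans ⟨δ, δ f ⟩ (δ-same f))) ⟨δf,δf⟩≡0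
      δf∷u-indep = extend {u = u} (LinIndep⇒Independent {u = u} indep) u⊥δf δf⊥̸δf
      δf∷u⊥w : ∀ i → ⟨ (δ f ∷ u) i , cutDiff ⟩ ≡ 0ℚ
      δf∷u⊥w zero    = trans ⟨δ, cutDiff ⟩ (cong₂ (λ x y → toℚ x - toℚ y)
                         (trans (separates-edge X b b′ b≢b′) (cong₂ _xor_ Xb Xb′))
                         (trans (separates-edge Y b b′ b≢b′) (cong₂ _xor_ Yb Yb′)))
      δf∷u⊥w (suc i) = cones⊆ker (u∈C i)

    nested⇒HasIndep : X ≢ Y → ¬ Crossing X Y → HasIndep C (d ∸ 1)
    nested⇒HasIndep X≢Y ¬crossing with atom? X Y true true
    ... | no X∩Y≡∅ =
      HasIndep-map {C = λ c → Kmin X c × Kmin (∁ Y) c} {C′ = C} (λ (KX , K∁Y) → KX , Kmin-∁ K∁Y)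
        (ThreeClasses.nested-family {A = X} {B = ∁ Y} X⊆∁Y Xa X₀ (∁Y-at Y₀) (∁Y-at Yz))
      where
      Xa = ∈⇒lookup (proj₂ (proj₂ X-cut))
      Yz = ∈⇒lookup (proj₂ (proj₂ Y-cut))
      ∁Y-at : ∀ {v b} → lookup Y v ≡ b → lookup (∁ Y) v ≡ not b
      ∁Y-at {v} Yv≡b = trans (lookup-map v not Y) (cong not Yv≡b)
      X⊆∁Y : ∀ v → lookup X v ≡ true → lookup (∁ Y) v ≡ true
      X⊆∁Y v Xv = ∁Y-at (¬-not (λ Yv → X∩Y≡∅ (v , Xv , Yv)))
    ... | yes (a , Xa , Ya) with atom? X Y true false
    ...   | no X∖Y≡∅ = ThreeClasses.nested-family {A = X} {B = Y} X⊆Y Xa Xm Ym Y₀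
      where
      X⊆Y : ∀ v → lookup X v ≡ true → lookup Y v ≡ true
      X⊆Y v Xv = ¬-not (λ Yv → X∖Y≡∅ (v , Xv , Yv))
      m = proj₁ (differing-vertex X≢Y)
      Xm≢Ym = proj₂ (differing-vertex X≢Y)
      Xm : lookup X m ≡ false
      Xm = ¬-not (λ Xm → Xm≢Ym (trans Xm (sym (X⊆Y m Xm))))
      Ym : lookup Y m ≡ true
      Ym = ¬-not (λ Ym → Xm≢Ym (trans Xm (sym Ym)))
    ...   | yes (m , Xm , Ym) with atom? X Y false true
    ...     | yes Y∖X≢∅ = ⊥-elim (¬crossing ((a , Xa , Ya) , (m , Xm , Ym) , Y∖X≢∅))
    ...     | no Y∖X≡∅ =
      HasIndep-map {C = λ c → Kmin Y c × Kmin X c} {C′ = C} (λ (KY , KX) → KX , KY)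
        (ThreeClasses.nested-family {A = Y} {B = X} Y⊆X Ya Ym Xm X₀)
      where
      Y⊆X : ∀ v → lookup Y v ≡ true → lookup X v ≡ true
      Y⊆X v Yv = ¬-not (λ Xv → Y∖X≡∅ (v , Xv , Yv))

    Adjacent⇔ : Adjacent X Y ⇔ (X ≢ Y × ¬ Crossing X Y)
    Adjacent⇔ = mk⇔
      (λ (X≢Y , HasIndep-d∸1 , _) → X≢Y , λ crossing → crossing⇒¬HasIndep X≢Y crossing HasIndep-d∸1)
      (λ (X≢Y , ¬crossing) → X≢Y , nested⇒HasIndep X≢Y ¬crossing , distinct⇒¬HasIndep X≢Y)

module Counting where

  open import Data.Nat using (suc; _+_; _∸_; _≤_; _^_; z≤n; s≤s)
  open import Data.Nat.Properties using (+-suc; +-identityʳ; ∸-monoʳ-≤; m+n∸n≡m; module ≤-Reasoning)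
  open import Data.Bool using (true; false)
  open import Data.Vec using ([]; _∷_)
  import Data.Vec as Vec
  open import Data.Vec.Properties using (∷-injectiveʳ)
  open import Data.Fin.Subset using (Subset; ∣_∣; ⁅_⁆; _⊆_) renaming (_∈_ to _∈ˢ_)
  open import Data.Fin.Subset.Properties
    using (drop-∷-⊆; out⊆; s⊆s; ∣⁅x⁆∣≡1; p⊆q⇒∣p∣≤∣q∣; x∈⁅y⁆⇒x≡y)
  open import Data.List using (List; []; _∷_; length; map; filter; _++_)
  open import Data.List.Properties using (length-map; length-++; map-∘; map-id-local)
  open import Data.List.Membership.Propositional using (_∈_)
  open import Data.List.Membership.Propositional.Properties
    using (∈-map⁺; ∈-map⁻; ∈-++⁺ˡ; ∈-++⁺ʳ; ∈-++⁻; ∈-filter⁻)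
  open import Data.List.Relation.Unary.Any using (here; there)
  open import Data.List.Relation.Unary.All using (All; []; _∷_)
  import Data.List.Relation.Unary.All as All
  open import Data.List.Relation.Unary.Unique.Propositional using (Unique; []; _∷_)
  import Data.List.Relation.Unary.Unique.Propositional.Properties as Unique
  open import Data.Product using (_×_; _,_)
  open import Function using (_∘_)
  open import Data.Sum using (inj₁; inj₂)
  open import Relation.Binary.PropositionalEquality
  open import Relation.Nullary using (¬_; yes; no; ¬?)
  open import Relation.Unary using (Pred; Decidable)
  open import Data.Empty using (⊥-elim)
  open import Level using (0ℓ)

  module _ {A : Set} where

    private
      remove : ∀ {x : A} {ys} → x ∈ ys → List A
      remove {ys = _ ∷ ys} (here _)  = ys
      remove {ys = y ∷ ys} (there p) = y ∷ remove p

      length-remove : ∀ {x : A} {ys} (p : x ∈ ys) → length ys ≡ suc (length (remove p))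
      length-remove (here _)              = refl
      length-remove {ys = _ ∷ _} (there p) = cong suc (length-remove p)

      ∈-remove : ∀ {x y : A} {ys} (p : x ∈ ys) → y ∈ ys → y ≢ x → y ∈ remove p
      ∈-remove (here refl) (here refl) y≢x = ⊥-elim (y≢x refl)
      ∈-remove (here refl) (there q)   _   = q
      ∈-remove (there p)   (here refl) _   = here refl
      ∈-remove (there p)   (there q)   y≢x = there (∈-remove p q y≢x)

    unique-⊆-length : ∀ {xs ys : List A} → Unique xs → (∀ {x} → x ∈ xs → x ∈ ys) →
      length xs ≤ length ys
    unique-⊆-length {[]}     _            _     = z≤n
    unique-⊆-length {x ∷ xs} {ys} (x∉xs ∷ xs!) xs⊆ys =
      subst (suc (length xs) ≤_) (sym (length-remove x∈ys)) (s≤s (unique-⊆-length xs! xs⊆ys∖x))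
      where
      x∈ys = xs⊆ys (here refl)
      xs⊆ys∖x : ∀ {y} → y ∈ xs → y ∈ remove x∈ys
      xs⊆ys∖x y∈xs = ∈-remove x∈ys (xs⊆ys (there y∈xs)) (λ y≡x → All.lookup x∉xs y∈xs (sym y≡x))

    length-filter-split : ∀ {P : Pred A 0ℓ} (P? : Decidable P) xs →
      length (filter P? xs) + length (filter (¬? ∘ P?) xs) ≡ length xs
    length-filter-split P? [] = refl
    length-filter-split P? (x ∷ xs) with P? x
    ... | yes _ = cong suc (length-filter-split P? xs)
    ... | no _  = trans (+-suc _ _) (cong suc (length-filter-split P? xs))

    unique-map : ∀ {B : Set} (f : A → B) (g : B → A) {xs} →
      All (λ x → g (f x) ≡ x) xs → Unique xs → Unique (map f xs)
    unique-map f g {xs} gf≡id xs! =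
      Unique.map⁻ {f = g} (subst Unique (sym (trans (sym (map-∘ xs)) (map-id-local gf≡id))) xs!)

  subsets : ∀ {k} → Subset k → List (Subset k)
  subsets []          = [] ∷ []
  subsets (false ∷ T) = map (false ∷_) (subsets T)
  subsets (true ∷ T)  = map (false ∷_) (subsets T) ++ map (true ∷_) (subsets T)

  length-subsets : ∀ {k} (T : Subset k) → length (subsets T) ≡ 2 ^ ∣ T ∣
  length-subsets []          = refl
  length-subsets (false ∷ T) = trans (length-map (false ∷_) (subsets T)) (length-subsets T)
  length-subsets (true ∷ T)  = begin
    length (map (false ∷_) (subsets T) ++ map (true ∷_) (subsets T))
      ≡⟨ length-++ (map (false ∷_) (subsets T)) ⟩
    length (map (false ∷_) (subsets T)) + length (map (true ∷_) (subsets T))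
      ≡⟨ cong₂ _+_ (length-map (false ∷_) (subsets T)) (length-map (true ∷_) (subsets T)) ⟩
    length (subsets T) + length (subsets T)
      ≡⟨ cong₂ _+_ (length-subsets T) (trans (length-subsets T) (sym (+-identityʳ (2 ^ ∣ T ∣)))) ⟩
    2 ^ ∣ T ∣ + (2 ^ ∣ T ∣ + 0) ∎
    where open ≡-Reasoning

  subsets-unique : ∀ {k} (T : Subset k) → Unique (subsets T)
  subsets-unique []          = [] ∷ []
  subsets-unique (false ∷ T) = Unique.map⁺ ∷-injectiveʳ (subsets-unique T)
  subsets-unique (true ∷ T)  = Unique.++⁺ (tagged false) (tagged true) disjoint
    where
    tagged : ∀ b → Unique (map (b ∷_) (subsets T))
    tagged b = Unique.map⁺ ∷-injectiveʳ (subsets-unique T)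
    disjoint : ∀ {Y} → ¬ (Y ∈ map (false ∷_) (subsets T) × Y ∈ map (true ∷_) (subsets T))
    disjoint (p , q) with ∈-map⁻ (false ∷_) p | ∈-map⁻ (true ∷_) q
    ... | _ , _ , refl | _ , _ , ()

  ∈-subsets⁺ : ∀ {k} {Y T : Subset k} → Y ⊆ T → Y ∈ subsets T
  ∈-subsets⁺ {Y = []}        {[]}        _    = here refl
  ∈-subsets⁺ {Y = false ∷ Y} {false ∷ T} Y⊆T = ∈-map⁺ (false ∷_) (∈-subsets⁺ (drop-∷-⊆ Y⊆T))
  ∈-subsets⁺ {Y = true ∷ Y}  {false ∷ T} Y⊆T with () ← Y⊆T Vec.here
  ∈-subsets⁺ {Y = false ∷ Y} {true ∷ T}  Y⊆T =
    ∈-++⁺ˡ (∈-map⁺ (false ∷_) (∈-subsets⁺ (drop-∷-⊆ Y⊆T)))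
  ∈-subsets⁺ {Y = true ∷ Y}  {true ∷ T}  Y⊆T =
    ∈-++⁺ʳ (map (false ∷_) (subsets T)) (∈-map⁺ (true ∷_) (∈-subsets⁺ (drop-∷-⊆ Y⊆T)))

  ∈-subsets⁻ : ∀ {k} {Y T : Subset k} → Y ∈ subsets T → Y ⊆ T
  ∈-subsets⁻ {T = []} (here refl) ()
  ∈-subsets⁻ {T = false ∷ T} Y∈ with ∈-map⁻ (false ∷_) Y∈
  ... | _ , Y′∈ , refl = out⊆ (∈-subsets⁻ Y′∈)
  ∈-subsets⁻ {T = true ∷ T} Y∈ with ∈-++⁻ (map (false ∷_) (subsets T)) Y∈
  ... | inj₁ Y∈₀ with ∈-map⁻ (false ∷_) Y∈₀
  ...   | _ , Y′∈ , refl = out⊆ (∈-subsets⁻ Y′∈)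
  ∈-subsets⁻ {T = true ∷ T} Y∈ | inj₂ Y∈₁ with ∈-map⁻ (true ∷_) Y∈₁
  ...   | _ , Y′∈ , refl = s⊆s (∈-subsets⁻ Y′∈)

  module _ {A : Set} where

    length-filter-≥ : ∀ {P : Pred A 0ℓ} (P? : Decidable P) {xs ys : List A} → Unique xs →
      (∀ {x} → x ∈ xs → ¬ P x → x ∈ ys) → length xs ∸ length ys ≤ length (filter P? xs)
    length-filter-≥ P? {xs} {ys} xs! rejected⊆ys = begin
      length xs ∸ length ys
        ≤⟨ ∸-monoʳ-≤ (length xs) rejected≤ys ⟩
      length xs ∸ length rejected
        ≡⟨ cong (_∸ length rejected) (length-filter-split P? xs) ⟨
      length (filter P? xs) + length rejected ∸ length rejected
        ≡⟨ m+n∸n≡m (length (filter P? xs)) (length rejected) ⟩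
      length (filter P? xs) ∎
      where
      open ≤-Reasoning
      rejected = filter (¬? ∘ P?) xs
      rejected≤ys : length rejected ≤ length ys
      rejected≤ys = unique-⊆-length (Unique.filter⁺ (¬? ∘ P?) xs!) λ x∈rejected →
        let x∈xs , ¬Px = ∈-filter⁻ (¬? ∘ P?) {xs = xs} x∈rejected in rejected⊆ys x∈xs ¬Px

  ∈⇒1≤∣∣ : ∀ {k} {p : Subset k} {i} → i ∈ˢ p → 1 ≤ ∣ p ∣
  ∈⇒1≤∣∣ {p = p} {i} i∈p = subst (_≤ ∣ p ∣) (∣⁅x⁆∣≡1 i) (p⊆q⇒∣p∣≤∣q∣ ⁅i⁆⊆p)
    where
    ⁅i⁆⊆p : ⁅ i ⁆ ⊆ p
    ⁅i⁆⊆p x∈⁅i⁆ = subst (_∈ˢ p) (sym (x∈⁅y⁆⇒x≡y i x∈⁅i⁆)) i∈p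

module PowerBounds where

  open import Data.Nat using (zero; suc; _+_; _*_; _∸_; _≤_; _^_; ⌈_/2⌉; ⌊_/2⌋)
  open import Data.Nat.Properties
    using ( +-suc; +-identityʳ; +-comm; m+n∸m≡n; +-monoʳ-≤; +-monoˡ-≤; ^-monoʳ-≤; m≤m+n; m≤n*m; m^n>0
          ; m+[n∸m]≡n; ≤-total; ∸-monoˡ-≤; ≤-refl; ≤-trans; ≤-reflexive; n≡⌈n+n/2⌉; n≡⌊n+n/2⌋
          ; module ≤-Reasoning)
  open import Data.Nat.Solver using (module +-*-Solver)
  open import Data.Sum using (inj₁; inj₂)
  open import Relation.Binary.PropositionalEquality

  -- Moving the two exponents towards each other never increases 2 ^ p + 2 ^ q.
  balanced-split : ∀ p d → 2 ^ ⌈ p + (p + d) /2⌉ + 2 ^ ⌊ p + (p + d) /2⌋ ≤ 2 ^ p + 2 ^ (p + d)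
  balanced-split p zero rewrite +-identityʳ p | sym (n≡⌈n+n/2⌉ p) | sym (n≡⌊n+n/2⌋ p) = ≤-refl
  balanced-split p (suc zero)
    rewrite +-suc p 0 | +-identityʳ p | +-suc p p | sym (n≡⌈n+n/2⌉ p) | sym (n≡⌊n+n/2⌋ p) =
    ≤-reflexive (+-comm (2 ^ suc p) (2 ^ p))
  balanced-split p (suc (suc d)) = begin
    2 ^ ⌈ p + (p + suc (suc d)) /2⌉ + 2 ^ ⌊ p + (p + suc (suc d)) /2⌋
      ≡⟨ cong (λ t → 2 ^ ⌈ t /2⌉ + 2 ^ ⌊ t /2⌋) shift ⟩
    2 ^ ⌈ suc p + (suc p + d) /2⌉ + 2 ^ ⌊ suc p + (suc p + d) /2⌋
      ≤⟨ balanced-split (suc p) d ⟩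
    2 * x + 2 * y
      ≡⟨ solve 2 (λ x y → con 2 :* x :+ con 2 :* y := x :+ (x :+ con 2 :* y)) refl x y ⟩
    x + (x + 2 * y)
      ≤⟨ +-monoʳ-≤ x (+-monoˡ-≤ (2 * y) (≤-trans (^-monoʳ-≤ 2 (m≤m+n p d)) (m≤n*m y 2))) ⟩
    x + (2 * y + 2 * y)
      ≡⟨ solve 2 (λ x y → x :+ (con 2 :* y :+ con 2 :* y) := x :+ con 2 :* (con 2 :* y)) refl x y ⟩
    x + 2 * (2 * y)
      ≡⟨ cong (λ t → x + 2 ^ t) (sym (trans (+-suc p (suc d)) (cong suc (+-suc p d)))) ⟩
    2 ^ p + 2 ^ (p + suc (suc d)) ∎
    where
    open ≤-Reasoning
    open +-*-Solver
    x = 2 ^ p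
    y = 2 ^ (p + d)
    shift : p + (p + suc (suc d)) ≡ suc p + (suc p + d)
    shift = trans (cong (p +_) (trans (+-suc p (suc d)) (cong suc (+-suc p d)))) (+-suc p (suc (p + d)))

  private
    ordered : ∀ {p q} → p ≤ q → 2 ^ ⌈ p + q /2⌉ + 2 ^ ⌊ p + q /2⌋ ≤ 2 ^ p + 2 ^ q
    ordered {p} {q} p≤q = subst (λ t → 2 ^ ⌈ p + t /2⌉ + 2 ^ ⌊ p + t /2⌋ ≤ 2 ^ p + 2 ^ t)
                                (m+[n∸m]≡n p≤q) (balanced-split p (q ∸ p))

  balanced-≤ : ∀ p q → 2 ^ ⌈ p + q /2⌉ + 2 ^ ⌊ p + q /2⌋ ≤ 2 ^ p + 2 ^ q
  balanced-≤ p q with ≤-total p q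
  ... | inj₁ p≤q = ordered p≤q
  ... | inj₂ q≤p =
    subst₂ (λ s t → 2 ^ ⌈ s /2⌉ + 2 ^ ⌊ s /2⌋ ≤ t) (+-comm q p) (+-comm (2 ^ q) (2 ^ p)) (ordered q≤p)

  balanced-≤-nestedCount : ∀ k j → 1 ≤ k →
    2 ^ ⌈ k + suc j /2⌉ + 2 ^ ⌊ k + suc j /2⌋ ∸ 4 ≤ (2 ^ k ∸ 2) + ((2 ^ j ∸ 1) + (2 ^ j ∸ 1))
  balanced-≤-nestedCount (suc k) j _ =
    ≤-trans (∸-monoˡ-≤ 4 (balanced-≤ (suc k) (suc j))) (≤-reflexive (regroup (m^n>0 2 k) (m^n>0 2 j)))
    where
    regroup : ∀ {P Q} → 1 ≤ P → 1 ≤ Q → 2 * P + 2 * Q ∸ 4 ≡ (2 * P ∸ 2) + ((Q ∸ 1) + (Q ∸ 1))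
    regroup {suc P} {suc Q} _ _ = begin
      2 * suc P + 2 * suc Q ∸ 4
        ≡⟨ cong (_∸ 4) (solve 2 (λ P Q → con 2 :* (con 1 :+ P) :+ con 2 :* (con 1 :+ Q)
                                        := con 4 :+ (con 2 :* P :+ (Q :+ Q))) refl P Q) ⟩
      4 + (2 * P + (Q + Q)) ∸ 4
        ≡⟨ m+n∸m≡n 4 (2 * P + (Q + Q)) ⟩
      2 * P + (Q + Q)
        ≡⟨ cong (λ t → t ∸ 2 + (Q + Q))
                (solve 1 (λ P → con 2 :* (con 1 :+ P) := con 2 :+ con 2 :* P) refl P) ⟨
      2 * suc P ∸ 2 + (Q + Q) ∎
      where
      open ≡-Reasoning
      open +-*-Solver

open import Defs
open SubsetLookup using (lookup⇒∈; lookup⇒∉)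
open Adjacency
open Counting
open PowerBounds
open import Data.Nat using (ℕ; suc; _≤_; _+_; _∸_; _^_; ⌈_/2⌉; ⌊_/2⌋)
open import Data.Nat.Properties
  using (≤-trans; ≤-reflexive; +-comm; +-suc; +-mono-≤; m+n≤o⇒m≤o∸n; m+[n∸m]≡n; module ≤-Reasoning)
open import Data.Bool using (true; false)
open import Data.Bool.Properties using () renaming (_≟_ to _≟ᴮ_)
open import Data.Fin using (zero; suc)
open import Data.Fin.Subset using (Subset; Nonempty; ∁; _∪_; _∩_; ⊤; ∣_∣; _⊆_)
  renaming (⊥ to ∅; _∈_ to _∈ˢ_; _∉_ to _∉ˢ_)
open import Data.Fin.Subset.Properties
  using ( ∣∁p∣≡n∸∣p∣; ∣p∣≤n; nonempty?; ⊆⊤; ∣⊤∣≡n; Empty-unique; ∉⊥; x∈∁p⇒x∉p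
        ; p⊆p∪q; q⊆p∪q; x∈p∪q⁻; x∈p∩q⁺; x∈p∩q⁻; ⊆-antisym)
open import Data.Vec using ([]; _∷_; lookup)
import Data.Vec as Vec
open import Data.Vec.Properties using (≡-dec; ∷-injectiveʳ)
open import Data.List using (List; []; _∷_; length; map; filter; _++_)
open import Data.List.Properties using (length-map; length-++)
open import Data.List.Membership.Propositional using (_∈_)
open import Data.List.Membership.Propositional.Properties
  using (∈-map⁺; ∈-map⁻; ∈-filter⁺; ∈-filter⁻; ∈-++⁻)
open import Data.List.Relation.Unary.Any using (here; there)
open import Data.List.Relation.Unary.All as All using (All)
open import Data.List.Relation.Unary.Unique.Propositional using (Unique; _∷_)
import Data.List.Relation.Unary.Unique.Propositional.Properties as Unique
open import Data.Product using (Σ; _×_; _,_; proj₁; proj₂)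
open import Data.Sum using (inj₁; inj₂)
open import Function using (_∘_)
open import Function.Bundles using (_⇔_; mk⇔; Equivalence)
open import Relation.Binary.PropositionalEquality
open import Relation.Nullary using (¬_; Dec; yes; no; ¬?)
open import Relation.Nullary.Decidable using (_×-dec_)
open import Data.Empty using (⊥-elim)

nonempty-tail : ∀ {k} {S : Subset k} → Nonempty (false ∷ S) → Nonempty S
nonempty-tail (suc i , Vec.there i∈S) = i , i∈S

module AdjacentCuts {n : ℕ} (X′ : Subset n) (X-nonempty : Nonempty (false ∷ X′)) where

  X : Subset (suc n)
  X = false ∷ X′

  X-cut : IsCut X
  X-cut = refl , X-nonempty

  Candidate : Subset (suc n) → Set
  Candidate Y = IsCut Y × X ≢ Y × ¬ Crossing X Y

  isCut? : ∀ (Y : Subset (suc n)) → Dec (IsCut Y)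
  isCut? (b ∷ Y′) = (b ≟ᴮ false) ×-dec nonempty? (b ∷ Y′)

  candidate? : ∀ Y → Dec (Candidate Y)
  candidate? Y = isCut? Y ×-dec ¬? (≡-dec _≟ᴮ_ X Y) ×-dec ¬? (crossing? X Y)

  zero-free : List (Subset (suc n))
  zero-free = map (false ∷_) (subsets ⊤)

  ∈zero-free : ∀ {Y} → ZeroNotIn Y → Y ∈ zero-free
  ∈zero-free {false ∷ Y′} refl = ∈-map⁺ (false ∷_) (∈-subsets⁺ ⊆⊤)

  adjacentCuts : List (Subset (suc n))
  adjacentCuts = filter candidate? zero-free

  adjacentCuts-unique : Unique adjacentCuts
  adjacentCuts-unique =
    Unique.filter⁺ candidate? {xs = zero-free} (Unique.map⁺ ∷-injectiveʳ (subsets-unique (⊤ {n})))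

  ∈-adjacentCuts⁺ : ∀ {Y} → Candidate Y → Y ∈ adjacentCuts
  ∈-adjacentCuts⁺ Y-cand = ∈-filter⁺ candidate? (∈zero-free (proj₁ (proj₁ Y-cand))) Y-cand

  ∈-adjacentCuts⁻ : ∀ {Y} → Y ∈ adjacentCuts → Candidate Y
  ∈-adjacentCuts⁻ Y∈ = proj₂ (∈-filter⁻ candidate? {xs = zero-free} Y∈)

  ∈-adjacentCuts : ∀ Y → (Y ∈ adjacentCuts) ⇔ (IsCut Y × Adjacent X Y)
  ∈-adjacentCuts Y = mk⇔
    (λ Y∈ → let Y-cut , nested = ∈-adjacentCuts⁻ Y∈ in
            Y-cut , Equivalence.from (Adjacent⇔ X-cut Y-cut) nested)
    (λ (Y-cut , adjacent) → ∈-adjacentCuts⁺ (Y-cut , Equivalence.to (Adjacent⇔ X-cut Y-cut) adjacent))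

  ∅≢cut : ∀ {Y : Subset (suc n)} → IsCut Y → ∅ ≢ Y
  ∅≢cut (_ , v , v∈Y) ∅≡Y = ∉⊥ (subst (v ∈ˢ_) (sym ∅≡Y) v∈Y)

  adjacentCuts-≤ : length adjacentCuts ≤ 2 ^ n ∸ 2
  adjacentCuts-≤ = m+n≤o⇒m≤o∸n (length adjacentCuts) (begin
    length adjacentCuts + 2        ≡⟨ +-comm (length adjacentCuts) 2 ⟩
    length (∅ ∷ X ∷ adjacentCuts)  ≤⟨ unique-⊆-length ∅∷X∷adjacentCuts-unique ⊆zero-free ⟩
    length zero-free               ≡⟨ length-map (false ∷_) (subsets (⊤ {n})) ⟩
    length (subsets (⊤ {n}))       ≡⟨ trans (length-subsets (⊤ {n})) (cong (2 ^_) (∣⊤∣≡n n)) ⟩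
    2 ^ n                          ∎)
    where
    open ≤-Reasoning
    ∅∷X∷adjacentCuts-unique : Unique (∅ ∷ X ∷ adjacentCuts)
    ∅∷X∷adjacentCuts-unique =
      (∅≢cut X-cut All.∷ All.tabulate (∅≢cut ∘ proj₁ ∘ ∈-adjacentCuts⁻))
      ∷ All.tabulate (proj₁ ∘ proj₂ ∘ ∈-adjacentCuts⁻)
      ∷ adjacentCuts-unique
    ⊆zero-free : ∀ {Y} → Y ∈ ∅ ∷ X ∷ adjacentCuts → Y ∈ zero-free
    ⊆zero-free (here refl)         = ∈zero-free refl
    ⊆zero-free (there (here refl)) = ∈zero-free refl
    ⊆zero-free (there (there Y∈))  = proj₁ (∈-filter⁻ candidate? {xs = zero-free} Y∈)

  T : Subset (suc n)
  T = false ∷ ∁ X′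

  T-disjoint : ∀ {v} → v ∈ˢ T → v ∉ˢ X
  T-disjoint (Vec.there v∈∁X′) (Vec.there v∈X′) = x∈∁p⇒x∉p v∈∁X′ v∈X′

  ⊆-ZeroNotIn : ∀ {Y S : Subset (suc n)} → lookup S zero ≡ false → Y ⊆ S → ZeroNotIn Y
  ⊆-ZeroNotIn {false ∷ _} _ _ = refl
  ⊆-ZeroNotIn {true ∷ _} S₀ Y⊆S = ⊥-elim (lookup⇒∉ S₀ (Y⊆S Vec.here))

  ZeroNotIn-∪ : ∀ {Y Z : Subset (suc n)} → ZeroNotIn Y → ZeroNotIn Z → ZeroNotIn (Y ∪ Z)
  ZeroNotIn-∪ {false ∷ _} {false ∷ _} refl refl = refl

  sub-candidate : ∀ {Y} → Y ⊆ X → Nonempty Y → Y ≢ X → Candidate Y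
  sub-candidate Y⊆X Y≠∅ Y≢X =
    (⊆-ZeroNotIn refl Y⊆X , Y≠∅) , Y≢X ∘ sym ,
    λ (_ , _ , v , Xv , Yv) → lookup⇒∉ Xv (Y⊆X (lookup⇒∈ Yv))

  disjoint-candidate : ∀ {Y} → Y ⊆ T → Nonempty Y → Candidate Y
  disjoint-candidate {Y} Y⊆T Y≠∅ =
    (⊆-ZeroNotIn refl Y⊆T , Y≠∅) , X≢Y ,
    λ ((v , Xv , Yv) , _) → T-disjoint (Y⊆T (lookup⇒∈ Yv)) (lookup⇒∈ Xv)
    where
    X≢Y : X ≢ Y
    X≢Y X≡Y = T-disjoint (Y⊆T (subst (_ ∈ˢ_) X≡Y (proj₂ X-nonempty))) (proj₂ X-nonempty)

  super-candidate : ∀ {W} → W ⊆ T → Nonempty W → Candidate (X ∪ W)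
  super-candidate {W} W⊆T (w , w∈W) =
    (ZeroNotIn-∪ {X} refl (⊆-ZeroNotIn refl W⊆T) , proj₁ X-nonempty , p⊆p∪q W (proj₂ X-nonempty)) ,
    X≢X∪W ,
    λ (_ , (v , Xv , X∪Wv) , _) → lookup⇒∉ {S = X ∪ W} X∪Wv (p⊆p∪q {p = X} W (lookup⇒∈ Xv))
    where
    X≢X∪W : X ≢ X ∪ W
    X≢X∪W X≡X∪W = T-disjoint (W⊆T w∈W) (subst (w ∈ˢ_) (sym X≡X∪W) (q⊆p∪q X W w∈W))

  Proper : Subset (suc n) → Set
  Proper Y = Nonempty Y × Y ≢ X

  proper? : ∀ Y → Dec (Proper Y)
  proper? Y = nonempty? Y ×-dec ¬? (≡-dec _≟ᴮ_ Y X)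

  subCuts disjointCuts superCuts nestedCuts : List (Subset (suc n))
  subCuts      = filter proper? (subsets X)
  disjointCuts = filter nonempty? (subsets T)
  superCuts    = map (X ∪_) disjointCuts
  nestedCuts   = subCuts ++ disjointCuts ++ superCuts

  ∈-subCuts⁻ : ∀ {Y} → Y ∈ subCuts → Y ⊆ X × Proper Y
  ∈-subCuts⁻ Y∈ = let Y∈subsets , Y-proper = ∈-filter⁻ proper? {xs = subsets X} Y∈ in
    ∈-subsets⁻ Y∈subsets , Y-proper

  ∈-disjointCuts⁻ : ∀ {Y} → Y ∈ disjointCuts → Y ⊆ T × Nonempty Y
  ∈-disjointCuts⁻ Y∈ = let Y∈subsets , Y≠∅ = ∈-filter⁻ nonempty? {xs = subsets T} Y∈ in
    ∈-subsets⁻ Y∈subsets , Y≠∅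

  nestedCuts⊆adjacentCuts : ∀ {Y} → Y ∈ nestedCuts → Y ∈ adjacentCuts
  nestedCuts⊆adjacentCuts Y∈ with ∈-++⁻ subCuts Y∈
  ... | inj₁ Y∈sub =
    let Y⊆X , Y≠∅ , Y≢X = ∈-subCuts⁻ Y∈sub in ∈-adjacentCuts⁺ (sub-candidate Y⊆X Y≠∅ Y≢X)
  ... | inj₂ Y∈rest with ∈-++⁻ disjointCuts Y∈rest
  ...   | inj₁ Y∈disjoint =
    let Y⊆T , Y≠∅ = ∈-disjointCuts⁻ Y∈disjoint in ∈-adjacentCuts⁺ (disjoint-candidate Y⊆T Y≠∅)
  ...   | inj₂ Y∈super with ∈-map⁻ (X ∪_) Y∈super
  ...     | W , W∈ , refl =
    let W⊆T , W≠∅ = ∈-disjointCuts⁻ W∈ in ∈-adjacentCuts⁺ (super-candidate W⊆T W≠∅)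

  ∪-∩T-inverse : ∀ {W} → W ⊆ T → (X ∪ W) ∩ T ≡ W
  ∪-∩T-inverse {W} W⊆T = ⊆-antisym ∪∩T⊆W (λ v∈W → x∈p∩q⁺ (q⊆p∪q X W v∈W , W⊆T v∈W))
    where
    ∪∩T⊆W : (X ∪ W) ∩ T ⊆ W
    ∪∩T⊆W v∈ with x∈p∩q⁻ (X ∪ W) T v∈
    ... | v∈X∪W , v∈T with x∈p∪q⁻ X W v∈X∪W
    ...   | inj₁ v∈X = ⊥-elim (T-disjoint v∈T v∈X)
    ...   | inj₂ v∈W = v∈W

  nestedCuts-unique : Unique nestedCuts
  nestedCuts-unique =
    Unique.++⁺ (Unique.filter⁺ proper? (subsets-unique X))
      (Unique.++⁺ disjointCuts-unique superCuts-unique disjoint∩super≡∅) sub∩rest≡∅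
    where
    disjointCuts-unique = Unique.filter⁺ nonempty? (subsets-unique T)
    superCuts-unique = unique-map (X ∪_) (_∩ T) (All.tabulate (∪-∩T-inverse ∘ proj₁ ∘ ∈-disjointCuts⁻))
                                  disjointCuts-unique
    disjoint∩super≡∅ : ∀ {Y} → ¬ (Y ∈ disjointCuts × Y ∈ superCuts)
    disjoint∩super≡∅ (Y∈d , Y∈s) with ∈-map⁻ (X ∪_) Y∈s
    ... | W , _ , refl =
      T-disjoint (proj₁ (∈-disjointCuts⁻ Y∈d) (p⊆p∪q W (proj₂ X-nonempty))) (proj₂ X-nonempty)
    sub∩rest≡∅ : ∀ {Y} → ¬ (Y ∈ subCuts × Y ∈ disjointCuts ++ superCuts)
    sub∩rest≡∅ (Y∈sub , Y∈rest) with ∈-subCuts⁻ Y∈sub | ∈-++⁻ disjointCuts Y∈rest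
    ... | Y⊆X , (y , y∈Y) , _ | inj₁ Y∈d = T-disjoint (proj₁ (∈-disjointCuts⁻ Y∈d) y∈Y) (Y⊆X y∈Y)
    ... | Y⊆X , _ | inj₂ Y∈s with ∈-map⁻ (X ∪_) Y∈s
    ...   | W , W∈ , refl =
      let W⊆T , w , w∈W = ∈-disjointCuts⁻ W∈ in T-disjoint (W⊆T w∈W) (Y⊆X (q⊆p∪q X W w∈W))

  length-subCuts : 2 ^ ∣ X′ ∣ ∸ 2 ≤ length subCuts
  length-subCuts = subst (λ t → t ∸ 2 ≤ length subCuts) (length-subsets X)
    (length-filter-≥ proper? {ys = ∅ ∷ X ∷ []} (subsets-unique X) improper)
    where
    improper : ∀ {Y} → Y ∈ subsets X → ¬ Proper Y → Y ∈ ∅ ∷ X ∷ []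
    improper {Y} _ ¬proper with ≡-dec _≟ᴮ_ Y X
    ... | yes Y≡X = there (here Y≡X)
    ... | no Y≢X  = here (Empty-unique (λ Y≠∅ → ¬proper (Y≠∅ , Y≢X)))

  length-disjointCuts : 2 ^ ∣ ∁ X′ ∣ ∸ 1 ≤ length disjointCuts
  length-disjointCuts = subst (λ t → t ∸ 1 ≤ length disjointCuts) (length-subsets T)
    (length-filter-≥ nonempty? {ys = ∅ ∷ []} (subsets-unique T) (λ _ Y-empty → here (Empty-unique Y-empty)))

  adjacentCuts-≥ : 2 ^ ⌈ suc n /2⌉ + 2 ^ ⌊ suc n /2⌋ ∸ 4 ≤ length adjacentCuts
  adjacentCuts-≥ = begin
    2 ^ ⌈ suc n /2⌉ + 2 ^ ⌊ suc n /2⌋ ∸ 4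
      ≡⟨ cong (λ t → 2 ^ ⌈ t /2⌉ + 2 ^ ⌊ t /2⌋ ∸ 4) k+1+j≡1+n ⟨
    2 ^ ⌈ k + suc j /2⌉ + 2 ^ ⌊ k + suc j /2⌋ ∸ 4
      ≤⟨ balanced-≤-nestedCount k j (∈⇒1≤∣∣ (proj₂ (nonempty-tail X-nonempty))) ⟩
    (2 ^ k ∸ 2) + ((2 ^ j ∸ 1) + (2 ^ j ∸ 1))
      ≤⟨ +-mono-≤ length-subCuts (+-mono-≤ length-disjointCuts
           (≤-trans length-disjointCuts (≤-reflexive (sym (length-map (X ∪_) disjointCuts))))) ⟩
    length subCuts + (length disjointCuts + length superCuts)
      ≡⟨ trans (length-++ subCuts) (cong (length subCuts +_) (length-++ disjointCuts)) ⟨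
    length nestedCuts
      ≤⟨ unique-⊆-length nestedCuts-unique nestedCuts⊆adjacentCuts ⟩
    length adjacentCuts ∎
    where
    open ≤-Reasoning
    k = ∣ X′ ∣
    j = ∣ ∁ X′ ∣
    k+1+j≡1+n : k + suc j ≡ suc n
    k+1+j≡1+n =
      trans (+-suc k j) (cong suc (trans (cong (k +_) (∣∁p∣≡n∸∣p∣ X′)) (m+[n∸m]≡n (∣p∣≤n X′))))

corollary1 : (n : ℕ) → 2 ≤ n → (X : Subset n) → IsCut X →
    Σ (List (Subset n)) (λ L →
    Unique L ×
    (∀ (Y : Subset n) → (Y ∈ L) ⇔ (IsCut Y × Adjacent X Y)) ×
    (2 ^ ⌈ n /2⌉ + 2 ^ ⌊ n /2⌋ ∸ 4 ≤ length L) ×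
    (length L ≤ 2 ^ (n ∸ 1) ∸ 2))
-- The hypothesis 2 ≤ n is implied by IsCut X.
corollary1 (suc n) _ (false ∷ X′) (refl , X-nonempty) =
  adjacentCuts , adjacentCuts-unique , ∈-adjacentCuts , adjacentCuts-≥ , adjacentCuts-≤
  where open AdjacentCuts X′ X-nonempty
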